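{- Let $m\ge 1$ and $t,s\ge 1$ be integers and let $G$ be a finite graph such that every prime induced subgraph of $G$ has linear clique-width at most $m$. If $\operatorname{lcw}(G)\ge (m+2)(t+s)$, then $G$ contains $Q_t$ or $\overline{Q}_s$ as an induced subgraph.
   Context: The linear clique-width $\operatorname{lcw}(G)$ of a graph $G$ is the smallest number of labels needed to construct $G$ by a sequence of the operations: (1) introduce a new vertex with some label; (2) for labels $i\neq j$, add edges between all vertices labeled $i$ and all vertices labeled $j$; (3) for labels $i\ne j$, relabel all vertices labeled $i$ to $j$. A module of $G$ is a set $M\subseteq V(G)$ such that every vertex outside $M$ is adjacent to all of $M$ or to none of $M$; the empty set, singletons and $V(G)$ are trivial modules. A graph is prime if it has at least two vertices and all its modules are trivial (so $K_2$ and $\overline{K}_2$ are prime). $G\uplus H$ denotes disjoint union and $G\ast H$ the join (disjoint union plus all edges between the two parts). The graphs $Q_t$ are defined by $Q_1=K_1$ and $Q_t=(K_1\ast Q_{t-1})\uplus Q_{t-1}$ for $t\ge 2$; $\overline{Q}_s$ is the complement of $Q_s$, so $\overline{Q}_1=K_1$ and $\overline{Q}_s=(K_1\uplus\overline{Q}_{s-1})\ast\overline{Q}_{s-1}$. -}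

module Defs where

open import Data.Nat using (ℕ; zero; suc; _+_; _*_; _≤_)
open import Data.Fin using (Fin; zero; suc; splitAt; _≟_)
open import Data.Bool using (Bool; true; false; _∧_; _∨_; not)
open import Data.Sum using (_⊎_; inj₁; inj₂)
open import Data.Product using (Σ; ∃; _×_; _,_)
open import Data.List using (List; []; _∷_; foldl)
open import Relation.Nullary using (¬_)
open import Relation.Nullary.Decidable using (⌊_⌋)
open import Relation.Binary.PropositionalEquality using (_≡_; _≢_; refl)
open import Function using (_∘_)
open import Function.Definitions using (Injective)

record Graph : Set where
  field
    size  : ℕ
    adj   : Fin size → Fin size → Bool
    sym   : ∀ x y → adj x y ≡ adj y x
    irrefl : ∀ x → adj x x ≡ false
open Graph public

record InducedSubgraph (H G : Graph) : Set where
  field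
    emb      : Fin (size H) → Fin (size G)
    emb-inj  : Injective _≡_ _≡_ emb
    emb-adj  : ∀ x y → adj H x y ≡ adj G (emb x) (emb y)

IsModule : (G : Graph) → (Fin (size G) → Bool) → Set
IsModule G M = ∀ v x y → M v ≡ false → M x ≡ true → M y ≡ true →
               adj G v x ≡ adj G v y

TrivialModule : (G : Graph) → (Fin (size G) → Bool) → Set
TrivialModule G M =
    (∀ x → M x ≡ false)
  ⊎ (Σ (Fin (size G)) λ v → M v ≡ true × (∀ y → M y ≡ true → y ≡ v))
  ⊎ (∀ x → M x ≡ true)

Prime : Graph → Set
Prime G = 2 ≤ size G × (∀ M → IsModule G M → TrivialModule G M)

data Op (k : ℕ) : Set where
  intro   : Fin k → Op k
  join    : (i j : Fin k) → i ≢ j → Op k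
  relabel : (i j : Fin k) → i ≢ j → Op k

record LGraph (k : ℕ) : Set where
  field
    n   : ℕ
    lab : Fin n → Fin k
    ladj : Fin n → Fin n → Bool
open LGraph public

_==_ : ∀ {k} → Fin k → Fin k → Bool
a == b = ⌊ a ≟ b ⌋

emptyLG : ∀ {k} → LGraph k
emptyLG = record { n = 0 ; lab = λ () ; ladj = λ () }

step : ∀ {k} → LGraph k → Op k → LGraph k
step {k} g (intro l) = record { n = suc (n g) ; lab = lab' ; ladj = adj' }
  where
    lab' : Fin (suc (n g)) → Fin k
    lab' zero = l
    lab' (suc x) = lab g x
    adj' : Fin (suc (n g)) → Fin (suc (n g)) → Bool
    adj' zero _ = false
    adj' (suc _) zero = false
    adj' (suc x) (suc y) = ladj g x y
step g (join i j _) = record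
  { n = n g ; lab = lab g
  ; ladj = λ x y → ladj g x y
                   ∨ ((lab g x == i) ∧ (lab g y == j))
                   ∨ ((lab g x == j) ∧ (lab g y == i)) }
step g (relabel i j _) = record
  { n = n g ; lab = λ x → if-eq (lab g x) ; ladj = ladj g }
  where
    if-eq : _ → _
    if-eq a with a ≟ i
    ... | Relation.Nullary.yes _ = j
    ... | Relation.Nullary.no _ = a

run : ∀ {k} → List (Op k) → LGraph k
run = foldl step emptyLG

record Iso {k : ℕ} (g : LGraph k) (G : Graph) : Set where
  field
    to    : Fin (n g) → Fin (size G)
    from  : Fin (size G) → Fin (n g)
    to-from : ∀ x → to (from x) ≡ x
    from-to : ∀ x → from (to x) ≡ x
    to-adj  : ∀ x y → ladj g x y ≡ adj G (to x) (to y)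

HasLinExpr : ℕ → Graph → Set
HasLinExpr k G = Σ (List (Op k)) λ ops → Iso (run ops) G

lcw≤ : Graph → ℕ → Set
lcw≤ G m = Σ ℕ λ k → k ≤ m × HasLinExpr k G

lcw≥ : Graph → ℕ → Set
lcw≥ G N = ∀ k → HasLinExpr k G → N ≤ k

K1 : Graph
K1 = record { size = 1 ; adj = λ _ _ → false ; sym = λ _ _ → refl ; irrefl = λ _ → refl }

module _ (G H : Graph) where
  private
    S = Fin (size G) ⊎ Fin (size H)
    uA : S → S → Bool
    uA (inj₁ a) (inj₁ b) = adj G a b
    uA (inj₂ a) (inj₂ b) = adj H a b
    uA _ _ = false
    jA : S → S → Bool
    jA (inj₁ a) (inj₁ b) = adj G a b
    jA (inj₂ a) (inj₂ b) = adj H a b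
    jA _ _ = true
    uS : ∀ p q → uA p q ≡ uA q p
    uS (inj₁ a) (inj₁ b) = sym G a b
    uS (inj₂ a) (inj₂ b) = sym H a b
    uS (inj₁ _) (inj₂ _) = refl
    uS (inj₂ _) (inj₁ _) = refl
    jS : ∀ p q → jA p q ≡ jA q p
    jS (inj₁ a) (inj₁ b) = sym G a b
    jS (inj₂ a) (inj₂ b) = sym H a b
    jS (inj₁ _) (inj₂ _) = refl
    jS (inj₂ _) (inj₁ _) = refl
    uI : ∀ p → uA p p ≡ false
    uI (inj₁ a) = irrefl G a
    uI (inj₂ a) = irrefl H a
    jI : ∀ p → jA p p ≡ false
    jI (inj₁ a) = irrefl G a
    jI (inj₂ a) = irrefl H a
    sp = splitAt (size G)

  _⊎ᴳ_ : Graph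
  _⊎ᴳ_ = record
    { size = size G + size H
    ; adj = λ x y → uA (sp x) (sp y)
    ; sym = λ x y → uS (sp x) (sp y)
    ; irrefl = λ x → uI (sp x) }

  _∗ᴳ_ : Graph
  _∗ᴳ_ = record
    { size = size G + size H
    ; adj = λ x y → jA (sp x) (sp y)
    ; sym = λ x y → jS (sp x) (sp y)
    ; irrefl = λ x → jI (sp x) }

-- Q t for t ≥ 1 (Q 0 is an unused dummy, set to K₁)
Q : ℕ → Graph
Q zero = K1
Q (suc zero) = K1
Q (suc (suc t)) = (K1 ∗ᴳ Q (suc t)) ⊎ᴳ Q (suc t)

coQ : ℕ → Graph
coQ zero = K1
coQ (suc zero) = K1
coQ (suc (suc s)) = (K1 ⊎ᴳ coQ (suc s)) ∗ᴳ coQ (suc s)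

-- By induction on t, s and |S|: if G[S] contains neither Q_t nor co-Q_s, then G[S] has a
-- linear expression with (m+2)(t+s-1) - 1 labels, which is less than (m+2)(t+s).
-- If G[S] is a disjoint union (dually, a join) with an indivisible side B and rest A, build A
-- with the full budget, collapse it to one label, and build B beside it with one label fewer.
-- That smaller budget suffices by induction unless both A and B contain Q_(t-1); but then every
-- part X of B that a vertex v of B sees uniformly (with the other polarity) is Q_(t-1)-free,
-- since v, a copy in X and the copy in A would form Q_t, and B is assembled from such parts.
-- Otherwise the maximal strong modules of G[S] have a prime quotient, which by hypothesis has
-- an expression with at most m labels. At most one module contains both Q_(t-1) and co-Q_(s-1)
-- (two would form Q_t or co-Q_s with a vertex telling them apart); it is built first and
-- collapsed to one label, and every other module is built with the smaller budget, on labels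
-- beyond those m + 1, at the moment the quotient's expression introduces it.

module Submission where

open import Defs hiding (sym)
open import Data.Nat as ℕ using (ℕ; zero; suc; _+_; _*_; _≤_; _<_; s≤s; z≤n)
open import Data.Nat.Properties
  using (≤-refl; ≤-trans; <-≤-trans; <-trans; ≤-pred; ≤-reflexive; n≤1+n; m≤n+m; m≤m+n; m<m+n; m≤n⇒m≤1+n; n≮0; <-irrefl; <⇒≢;
         +-suc; +-comm; +-assoc; +-identityʳ; *-suc; *-identityʳ; +-monoˡ-≤; +-monoʳ-<; +-cancelˡ-≡; m+1+n≢m)
  renaming (suc-injective to ℕ-suc-injective)
open import Data.Fin as Fin using (Fin; zero; suc; _≟_; inject≤; fromℕ<; toℕ; splitAt)
open import Data.Fin.Properties using (any?; all?; ¬∀⟶∃¬; join-splitAt; inject≤-injective; suc-injective; toℕ-fromℕ<; toℕ<n; toℕ-injective)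
open import Data.Bool using (Bool; true; false; _∧_; _∨_; not; if_then_else_)
import Data.Bool as Bool
open import Data.Bool.Properties
  using (∨-identityʳ; ∨-zeroʳ; ∧-zeroʳ; ∧-identityʳ; ∧-conicalˡ; ∧-conicalʳ; ¬-not; not-¬; not-involutive)
open import Data.Maybe using (Maybe; just; nothing)
import Data.Maybe as Maybe
open import Data.Maybe.Properties using (just-injective)
import Data.Maybe.Properties as Maybe
open import Data.Sum using (_⊎_; inj₁; inj₂; [_,_]′)
open import Data.Product using (Σ; _×_; _,_; proj₁; proj₂)
open import Data.List using (List; []; _∷_; _++_; foldl; map; filter; length; lookup; allFin)
open import Data.List.Properties using (foldl-++)
open import Data.List.Membership.Propositional using (_∈_)
open import Data.List.Membership.Propositional.Properties using (∈-filter⁺; ∈-filter⁻; ∈-allFin; ∈-lookup)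
open import Data.List.Relation.Unary.All using (All)
import Data.List.Relation.Unary.All as All
open import Data.List.Relation.Unary.Any using (index)
open import Data.List.Relation.Unary.Any.Properties using (lookup-index)
import Data.List.Relation.Unary.AllPairs as AllPairs
open import Data.List.Relation.Unary.Unique.Propositional using (Unique)
import Data.List.Relation.Unary.Unique.Propositional.Properties as Unique
import Data.Vec.Functional as Vector
open import Data.Unit using (⊤; tt)
open import Data.Empty using (⊥; ⊥-elim)
open import Function.Definitions using (Injective)
open import Relation.Nullary using (¬_; Dec; yes; no)
open import Relation.Nullary.Decidable using (⌊_⌋; _×-dec_; _→-dec_; ¬?; map′)
open import Relation.Unary using (Decidable)
open import Relation.Binary.Definitions using (DecidableEquality)
open import Relation.Binary.PropositionalEquality

true≢false : true ≢ false
true≢false ()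

⌊⌋-true : ∀ {A : Set} (d : Dec A) → ⌊ d ⌋ ≡ true → A
⌊⌋-true (yes a) _ = a

module _ {A : Set} (_≟ᴬ_ : DecidableEquality A) where

  ≟-refl : ∀ a → ⌊ a ≟ᴬ a ⌋ ≡ true
  ≟-refl a with a ≟ᴬ a
  ... | yes _ = refl
  ... | no a≢a = ⊥-elim (a≢a refl)

  ≟-≢ : ∀ {a b} → a ≢ b → ⌊ a ≟ᴬ b ⌋ ≡ false
  ≟-≢ {a} {b} a≢b with a ≟ᴬ b
  ... | yes a≡b = ⊥-elim (a≢b a≡b)
  ... | no _ = refl

  ≟-≡ : ∀ {a b} → ⌊ a ≟ᴬ b ⌋ ≡ true → a ≡ b
  ≟-≡ {a} {b} = ⌊⌋-true (a ≟ᴬ b)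

==-refl : ∀ {k} (a : Fin k) → (a == a) ≡ true
==-refl = ≟-refl _≟_

==-≢ : ∀ {k} {a b : Fin k} → a ≢ b → (a == b) ≡ false
==-≢ = ≟-≢ _≟_

==-≡ : ∀ {k} {a b : Fin k} → (a == b) ≡ true → a ≡ b
==-≡ = ≟-≡ _≟_

¬→-premise : ∀ {A C : Set} → Dec A → ¬ (A → C) → A
¬→-premise (yes a) _ = a
¬→-premise (no ¬a) ¬f = ⊥-elim (¬f (λ a → ⊥-elim (¬a a)))

¬→-conclusion : ∀ {A C : Set} → ¬ (A → C) → ¬ C
¬→-conclusion ¬f c = ¬f (λ _ → c)

¬∀²⇒∃¬ : ∀ n (P : Fin n → Fin n → Set) → (∀ x y → Dec (P x y)) → ¬ (∀ x y → P x y) → Σ (Fin n) λ x → Σ (Fin n) λ y → ¬ P x y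
¬∀²⇒∃¬ n P P? ¬∀ with ¬∀⟶∃¬ n (λ x → ∀ y → P x y) (λ x → all? (P? x)) ¬∀
... | x , ¬∀y with ¬∀⟶∃¬ n (P x) (P? x) ¬∀y
...   | y , ¬p = x , y , ¬p

¬∀³⇒∃¬ : ∀ n (P : Fin n → Fin n → Fin n → Set) → (∀ x y z → Dec (P x y z)) → ¬ (∀ x y z → P x y z) →
         Σ (Fin n) λ x → Σ (Fin n) λ y → Σ (Fin n) λ z → ¬ P x y z
¬∀³⇒∃¬ n P P? ¬∀ with ¬∀⟶∃¬ n (λ x → ∀ y z → P x y z) (λ x → all? (λ y → all? (P? x y))) ¬∀
... | x , ¬∀yz with ¬∀²⇒∃¬ n (P x) (P? x) ¬∀yz
...   | y , z , ¬p = x , y , z , ¬p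

Searchable : Set → Set₁
Searchable X = (P : X → Set) → Decidable P → Dec (Σ X P)

Bool-searchable : Searchable Bool
Bool-searchable P P? with P? true | P? false
... | yes p | _ = yes (true , p)
... | no _ | yes p = yes (false , p)
... | no ¬t | no ¬f = no λ { (true , p) → ¬t p ; (false , p) → ¬f p }

Fin-searchable : ∀ {n} → Searchable (Fin n)
Fin-searchable P P? = any? P?

-- the respect hypothesis stands in for function extensionality: witnesses are rebuilt pointwise
functions-searchable : ∀ q {X : Set} → Searchable X → (P : (Fin q → X) → Set) → Decidable P →
                       (∀ f g → (∀ i → f i ≡ g i) → P f → P g) → Dec (Σ (Fin q → X) P)
functions-searchable zero search P P? respects with P? (λ ())
... | yes p = yes ((λ ()) , p)
... | no ¬p = no λ { (f , pf) → ¬p (respects f (λ ()) (λ ()) pf) }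
functions-searchable (suc q) {X} search P P? respects
  with search (λ x → Σ (Fin q → X) λ g → P (x Vector.∷ g))
              (λ x → functions-searchable q search (λ g → P (x Vector.∷ g)) (λ g → P? (x Vector.∷ g))
                       (λ g g′ e → respects (x Vector.∷ g) (x Vector.∷ g′) λ { zero → refl ; (suc i) → e i }))
... | yes (x , g , p) = yes (x Vector.∷ g , p)
... | no ¬p = no λ { (f , pf) → ¬p (f zero , (λ i → f (suc i)) , respects f _ (λ { zero → refl ; (suc i) → refl }) pf) }

firstTrue : ∀ {n} → (Fin n → Bool) → Maybe (Fin n)
firstTrue {zero} P = nothing
firstTrue {suc n} P with P zero
... | true = just zero
... | false = Maybe.map suc (firstTrue (λ i → P (suc i)))

firstTrue-cong : ∀ {n} (P P′ : Fin n → Bool) → (∀ i → P i ≡ P′ i) → firstTrue P ≡ firstTrue P′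
firstTrue-cong {zero} P P′ e = refl
firstTrue-cong {suc n} P P′ e rewrite e zero with P′ zero
... | true = refl
... | false = cong (Maybe.map suc) (firstTrue-cong _ _ (λ i → e (suc i)))

firstTrue-sound : ∀ {n} (P : Fin n → Bool) x → firstTrue P ≡ just x → P x ≡ true
firstTrue-sound {suc n} P x e with P zero in ez
firstTrue-sound {suc n} P zero refl | true = ez
firstTrue-sound {suc n} P x e | false with firstTrue (λ i → P (suc i)) in e′
firstTrue-sound {suc n} P (suc x) refl | false | just y = firstTrue-sound (λ i → P (suc i)) x e′

firstTrue-complete : ∀ {n} (P : Fin n → Bool) x → P x ≡ true → Σ (Fin n) λ y → firstTrue P ≡ just y
firstTrue-complete {suc n} P x px with P zero in ez
... | true = zero , refl
firstTrue-complete {suc n} P zero px | false = ⊥-elim (true≢false (trans (sym px) ez))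
firstTrue-complete {suc n} P (suc x) px | false with firstTrue-complete (λ i → P (suc i)) x px
... | y , e rewrite e = suc y , refl

All-lookup : ∀ {A : Set} {P : A → Set} {xs : List A} → All P xs → ∀ i → P (lookup xs i)
All-lookup (px All.∷ _) zero = px
All-lookup (_ All.∷ pxs) (suc i) = All-lookup pxs i

Unique-lookup-injective : ∀ {A : Set} {xs : List A} → Unique xs → ∀ i j → lookup xs i ≡ lookup xs j → i ≡ j
Unique-lookup-injective (_ AllPairs.∷ _) zero zero _ = refl
Unique-lookup-injective (px AllPairs.∷ _) zero (suc j) e = ⊥-elim (All-lookup px j e)
Unique-lookup-injective (px AllPairs.∷ _) (suc i) zero e = ⊥-elim (All-lookup px i (sym e))
Unique-lookup-injective (_ AllPairs.∷ pxs) (suc i) (suc j) e = cong suc (Unique-lookup-injective pxs i j e)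

distinct⇒2≤ : ∀ {n} (i j : Fin n) → i ≢ j → 2 ≤ n
distinct⇒2≤ {suc zero} zero zero i≢j = ⊥-elim (i≢j refl)
distinct⇒2≤ {suc (suc n)} _ _ _ = s≤s (s≤s z≤n)

some : ∀ {n} → 2 ≤ n → Fin n
some (s≤s _) = zero

another : ∀ {n} → 2 ≤ n → (h : Fin n) → Σ (Fin n) λ h′ → h′ ≢ h
another (s≤s (s≤s _)) zero = suc zero , λ ()
another (s≤s (s≤s _)) (suc h) = zero , λ ()

_⊆_ : ∀ {X : Set} → (X → Bool) → (X → Bool) → Set
A ⊆ S = ∀ v → A v ≡ true → S v ≡ true

_∖_ : ∀ {X : Set} → (X → Bool) → (X → Bool) → X → Bool
(S ∖ B) v = S v ∧ not (B v)

∖⊆ : ∀ {X : Set} (S B : X → Bool) → (S ∖ B) ⊆ S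
∖⊆ S B v e = ∧-conicalˡ (S v) _ e

∖-∉ : ∀ {X : Set} (S B : X → Bool) v → (S ∖ B) v ≡ true → B v ≡ false
∖-∉ S B v e with B v
... | false = refl
... | true = ⊥-elim (true≢false (trans (sym e) (∧-zeroʳ (S v))))

∈⇒∉∖ : ∀ {X : Set} (S B : X → Bool) v → B v ≡ true → (S ∖ B) v ≡ false
∈⇒∉∖ S B v e rewrite e = ∧-zeroʳ (S v)

∖-cover : ∀ {X : Set} (S B : X → Bool) v → S v ≡ true → (S ∖ B) v ≡ true ⊎ B v ≡ true
∖-cover S B v sv with B v
... | true = inj₂ refl
... | false = inj₁ (trans (∧-identityʳ (S v)) sv)

count : ∀ {n} → (Fin n → Bool) → ℕ
count {zero} P = 0
count {suc n} P = (if P zero then 1 else 0) + count (λ i → P (suc i))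

count-mono : ∀ {n} (A S : Fin n → Bool) → A ⊆ S → count A ≤ count S
count-mono {zero} A S sub = z≤n
count-mono {suc n} A S sub with A zero in ea | S zero in es
... | true | true = s≤s (count-mono _ _ (λ v → sub (suc v)))
... | true | false = ⊥-elim (true≢false (trans (sym (sub zero ea)) es))
... | false | true = m≤n⇒m≤1+n (count-mono _ _ (λ v → sub (suc v)))
... | false | false = count-mono _ _ (λ v → sub (suc v))

count-< : ∀ {n} (A S : Fin n → Bool) → A ⊆ S → ∀ v → S v ≡ true → A v ≡ false → count A < count S
count-< {suc n} A S sub zero sv av rewrite sv | av = s≤s (count-mono _ _ (λ v → sub (suc v)))
count-< {suc n} A S sub (suc v) sv av with A zero in ea | S zero in es
... | true | true = s≤s (count-< _ _ (λ v → sub (suc v)) v sv av)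
... | true | false = ⊥-elim (true≢false (trans (sym (sub zero ea)) es))
... | false | true = m≤n⇒m≤1+n (count-< _ _ (λ v → sub (suc v)) v sv av)
... | false | false = count-< _ _ (λ v → sub (suc v)) v sv av

hasLabel : ∀ {k} → Maybe (Fin k) → Fin k → Bool
hasLabel (just a) i = a == i
hasLabel nothing  i = false

renameLabel : ∀ {k} → Fin k → Fin k → Fin k → Fin k
renameLabel i j a with a ≟ i
... | yes _ = j
... | no  _ = a

==-injective : ∀ {k K} (f : Fin k → Fin K) → Injective _≡_ _≡_ f → ∀ a b → (f a == f b) ≡ (a == b)
==-injective f f-inj a b with a ≟ b
... | yes refl = ==-refl (f a)
... | no a≢b = ==-≢ (λ e → a≢b (f-inj e))

renameLabel-≢ : ∀ {k} (i j a : Fin k) → a ≢ i → renameLabel i j a ≡ a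
renameLabel-≢ i j a a≢i with a ≟ i
... | yes a≡i = ⊥-elim (a≢i a≡i)
... | no _ = refl

renameLabel-natural : ∀ {k K} (f : Fin k → Fin K) → Injective _≡_ _≡_ f →
                      ∀ i j a → renameLabel (f i) (f j) (f a) ≡ f (renameLabel i j a)
renameLabel-natural f f-inj i j a with a ≟ i | f a ≟ f i
... | yes _ | yes _ = refl
... | yes refl | no ne = ⊥-elim (ne refl)
... | no ne | yes e = ⊥-elim (ne (f-inj e))
... | no _ | no _ = refl

hasLabel-≢ : ∀ {K} (m : Maybe (Fin K)) ℓ → m ≢ just ℓ → hasLabel m ℓ ≡ false
hasLabel-≢ nothing ℓ _ = refl
hasLabel-≢ (just c) ℓ ne = ==-≢ (λ e → ne (cong just e))

hasLabel-two : ∀ {k} (m : Maybe (Fin k)) x y → x ≢ y → hasLabel m x ∧ hasLabel m y ≡ false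
hasLabel-two nothing x y ne = refl
hasLabel-two (just c) x y ne with c ≟ x
... | no _ = refl
... | yes refl = ==-≢ ne

-- Defs.step numbers vertices by position, shifting them at every introduction; here each
-- introduced vertex gets a stable name from V, and a state maps names to labels
-- (nothing: not introduced yet).
module Named (V : Set) (_≟ⱽ_ : DecidableEquality V) where

  data NOp (k : ℕ) : Set where
    nintro   : V → Fin k → NOp k
    njoin    : (i j : Fin k) → i ≢ j → NOp k
    nrelabel : (i j : Fin k) → i ≢ j → NOp k

  record NState (k : ℕ) : Set where
    constructor nstate
    field
      label : V → Maybe (Fin k)
      edge  : V → V → Bool
  open NState public

  eqV : V → V → Bool
  eqV u v = ⌊ u ≟ⱽ v ⌋

  nstep : ∀ {k} → NState k → NOp k → NState k
  nstep σ (nintro v ℓ) =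
    nstate (λ u → if eqV u v then just ℓ else label σ u)
           (λ u w → if eqV u v ∨ eqV w v then false else edge σ u w)
  nstep σ (njoin i j _) =
    nstate (label σ) (λ u w → edge σ u w ∨ (hasLabel (label σ u) i ∧ hasLabel (label σ w) j)
                                          ∨ (hasLabel (label σ u) j ∧ hasLabel (label σ w) i))
  nstep σ (nrelabel i j _) = nstate (λ u → Maybe.map (renameLabel i j) (label σ u)) (edge σ)

  nrun : ∀ {k} → NState k → List (NOp k) → NState k
  nrun = foldl nstep

  nempty : ∀ {k} → NState k
  nempty = nstate (λ _ → nothing) (λ _ _ → false)

  Present : ∀ {k} → NState k → V → Set
  Present {k} σ v = Σ (Fin k) λ ℓ → label σ v ≡ just ℓ

  Absent : ∀ {k} → NState k → V → Set
  Absent σ v = label σ v ≡ nothing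

  ValidOver : ∀ {k} → (V → Bool) → NState k → List (NOp k) → Set
  ValidOver S σ [] = ⊤
  ValidOver S σ (nintro v ℓ ∷ os) = S v ≡ true × Absent σ v × ValidOver S (nstep σ (nintro v ℓ)) os
  ValidOver S σ (o@(njoin _ _ _) ∷ os) = ValidOver S (nstep σ o) os
  ValidOver S σ (o@(nrelabel _ _ _) ∷ os) = ValidOver S (nstep σ o) os

  erase : ∀ {k} → NOp k → Op k
  erase (nintro v ℓ) = intro ℓ
  erase (njoin i j p) = join i j p
  erase (nrelabel i j p) = relabel i j p

  record Represents {k} (g : LGraph k) (σ : NState k) : Set where
    field
      name           : Fin (n g) → V
      name-injective : ∀ x y → name x ≡ name y → x ≡ y
      name-label     : ∀ x → label σ (name x) ≡ just (lab g x)
      name-onto      : ∀ v → Present σ v → Σ (Fin (n g)) λ x → name x ≡ v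
      name-edge      : ∀ x y → ladj g x y ≡ edge σ (name x) (name y)

  represents-empty : ∀ {k} → Represents {k} emptyLG nempty
  represents-empty = record
    { name = λ () ; name-injective = λ () ; name-label = λ () ; name-onto = λ _ () ; name-edge = λ () }

  eqV-refl : ∀ v → eqV v v ≡ true
  eqV-refl = ≟-refl _≟ⱽ_

  eqV-≢ : ∀ {u v} → u ≢ v → eqV u v ≡ false
  eqV-≢ = ≟-≢ _≟ⱽ_

  renameLabel-step : ∀ {k} (g : LGraph k) i j p x →
                     just (renameLabel i j (lab g x)) ≡ just (lab (step g (relabel i j p)) x)
  renameLabel-step g i j p x with lab g x ≟ i
  ... | yes _ = refl
  ... | no  _ = refl

  represents-intro : ∀ {k} {g : LGraph k} {σ : NState k} v ℓ → Represents g σ → Absent σ v →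
                     Represents (step g (intro ℓ)) (nstep σ (nintro v ℓ))
  represents-intro {k} {g} {σ} v ℓ r fresh = record
    { name = name′ ; name-injective = injective ; name-label = labels ; name-onto = onto ; name-edge = edges }
    where
    open Represents r
    name≢v : ∀ x → name x ≢ v
    name≢v x e with trans (sym (name-label x)) (cong (label σ) e)
    ... | q rewrite fresh with q
    ... | ()
    name′ : Fin (suc (n g)) → V
    name′ zero = v
    name′ (suc x) = name x
    injective : ∀ x y → name′ x ≡ name′ y → x ≡ y
    injective zero zero e = refl
    injective zero (suc y) e = ⊥-elim (name≢v y (sym e))
    injective (suc x) zero e = ⊥-elim (name≢v x e)
    injective (suc x) (suc y) e = cong suc (name-injective x y e)
    labels : ∀ x → label (nstep σ (nintro v ℓ)) (name′ x) ≡ just (lab (step g (intro ℓ)) x)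
    labels zero rewrite eqV-refl v = refl
    labels (suc x) rewrite eqV-≢ (name≢v x) = name-label x
    onto : ∀ u → Present (nstep σ (nintro v ℓ)) u → Σ (Fin (suc (n g))) λ x → name′ x ≡ u
    onto u p with u ≟ⱽ v
    ... | yes u≡v = zero , sym u≡v
    ... | no  _ with name-onto u p
    ... | x , ex = suc x , ex
    edges : ∀ x y → ladj (step g (intro ℓ)) x y ≡ edge (nstep σ (nintro v ℓ)) (name′ x) (name′ y)
    edges zero y rewrite eqV-refl v = refl
    edges (suc x) zero rewrite eqV-refl v | eqV-≢ (name≢v x) = refl
    edges (suc x) (suc y) rewrite eqV-≢ (name≢v x) | eqV-≢ (name≢v y) = name-edge x y

  represents-step : ∀ {k} {g : LGraph k} {σ : NState k} {S} o → Represents g σ → ValidOver S σ (o ∷ []) →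
                    Represents (step g (erase o)) (nstep σ o)
  represents-step (nintro v ℓ) r (_ , fresh , _) = represents-intro v ℓ r fresh
  represents-step {g = g} {σ} (njoin i j p) r _ = record { Represents r ; name-edge = edges }
    where
    open Represents r
    edges : ∀ x y → ladj (step g (join i j p)) x y ≡ edge (nstep σ (njoin i j p)) (name x) (name y)
    edges x y rewrite name-label x | name-label y | name-edge x y = refl
  represents-step {g = g} {σ} (nrelabel i j p) r _ = record { Represents r ; name-label = labels ; name-onto = onto }
    where
    open Represents r
    labels : ∀ x → label (nstep σ (nrelabel i j p)) (name x) ≡ just (lab (step g (relabel i j p)) x)
    labels x rewrite name-label x = renameLabel-step g i j p x
    onto : ∀ u → Present (nstep σ (nrelabel i j p)) u → Σ (Fin (n g)) λ x → name x ≡ u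
    onto u p with label σ u in eq
    ... | just a = name-onto u (a , eq)

  present-relabel : ∀ {k} (σ : NState k) i j p u → Present (nstep σ (nrelabel i j p)) u → Present σ u
  present-relabel σ i j p u (b , e) with label σ u
  ... | just a = a , refl

  absent-relabel : ∀ {k} (σ : NState k) i j p u → Absent (nstep σ (nrelabel i j p)) u → Absent σ u
  absent-relabel σ i j p u e with label σ u
  ... | nothing = refl

  module _ {k} (σ : NState k) (v : V) (ℓ : Fin k) where

    intro-label-≢ : ∀ {u} → u ≢ v → label (nstep σ (nintro v ℓ)) u ≡ label σ u
    intro-label-≢ u≢v rewrite eqV-≢ u≢v = refl

    intro-label-new : label (nstep σ (nintro v ℓ)) v ≡ just ℓ
    intro-label-new rewrite eqV-refl v = refl

    intro-edge-≢ : ∀ {u w} → u ≢ v → w ≢ v → edge (nstep σ (nintro v ℓ)) u w ≡ edge σ u w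
    intro-edge-≢ u≢v w≢v rewrite eqV-≢ u≢v | eqV-≢ w≢v = refl

    intro-edge-newˡ : ∀ w → edge (nstep σ (nintro v ℓ)) v w ≡ false
    intro-edge-newˡ w rewrite eqV-refl v = refl

    intro-edge-newʳ : ∀ u → edge (nstep σ (nintro v ℓ)) u v ≡ false
    intro-edge-newʳ u rewrite eqV-refl v with eqV u v
    ... | true = refl
    ... | false = refl

  join-edge-unchanged : ∀ {k} (τ : NState k) i j p u w → hasLabel (label τ u) i ∧ hasLabel (label τ w) j ≡ false →
                        hasLabel (label τ u) j ∧ hasLabel (label τ w) i ≡ false → edge (nstep τ (njoin i j p)) u w ≡ edge τ u w
  join-edge-unchanged τ i j p u w e₁ e₂ rewrite e₁ | e₂ = ∨-identityʳ _

  join-same-label : ∀ {k} (τ : NState k) i j p u w → label τ u ≡ label τ w → edge (nstep τ (njoin i j p)) u w ≡ edge τ u w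
  join-same-label τ i j p u w same =
    join-edge-unchanged τ i j p u w (no-both-labels i j p) (no-both-labels j i (λ e → p (sym e)))
    where
    no-both-labels : ∀ x y → x ≢ y → hasLabel (label τ u) x ∧ hasLabel (label τ w) y ≡ false
    no-both-labels x y x≢y rewrite same = hasLabel-two (label τ w) x y x≢y

  join-ignores : ∀ {k} (τ : NState k) i j p u w ℓ → label τ u ≡ just ℓ → ℓ ≢ i → ℓ ≢ j →
                 edge (nstep τ (njoin i j p)) u w ≡ edge τ u w × edge (nstep τ (njoin i j p)) w u ≡ edge τ w u
  join-ignores τ i j p u w ℓ lu ℓ≢i ℓ≢j =
    join-edge-unchanged τ i j p u w e₁ e₂ , join-edge-unchanged τ i j p w u e₃ e₄
    where
    e₁ : hasLabel (label τ u) i ∧ hasLabel (label τ w) j ≡ false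
    e₁ rewrite lu | ==-≢ ℓ≢i = refl
    e₂ : hasLabel (label τ u) j ∧ hasLabel (label τ w) i ≡ false
    e₂ rewrite lu | ==-≢ ℓ≢j = refl
    e₃ : hasLabel (label τ w) i ∧ hasLabel (label τ u) j ≡ false
    e₃ rewrite lu | ==-≢ ℓ≢j = ∧-zeroʳ _
    e₄ : hasLabel (label τ w) j ∧ hasLabel (label τ u) i ≡ false
    e₄ rewrite lu | ==-≢ ℓ≢i = ∧-zeroʳ _

  valid-head : ∀ {k} {S} {σ : NState k} o os → ValidOver S σ (o ∷ os) → ValidOver S σ (o ∷ [])
  valid-head (nintro v ℓ) os (s , a , _) = s , a , tt
  valid-head (njoin i j p) os _ = tt
  valid-head (nrelabel i j p) os _ = tt

  valid-tail : ∀ {k} {S} {σ : NState k} o os → ValidOver S σ (o ∷ os) → ValidOver S (nstep σ o) os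
  valid-tail (nintro v ℓ) os (_ , _ , val) = val
  valid-tail (njoin i j p) os val = val
  valid-tail (nrelabel i j p) os val = val

  represents-run : ∀ {k} {S : V → Bool} (g : LGraph k) (σ : NState k) os → Represents g σ → ValidOver S σ os →
                   Represents (foldl step g (map erase os)) (nrun σ os)
  represents-run g σ [] r _ = r
  represents-run g σ (o ∷ os) r val =
    represents-run _ _ os (represents-step o r (valid-head o os val)) (valid-tail o os val)

  AllIntroduced : ∀ {k} → (V → Set) → List (NOp k) → Set
  AllIntroduced P [] = ⊤
  AllIntroduced P (nintro v ℓ ∷ os) = P v × AllIntroduced P os
  AllIntroduced P (njoin _ _ _ ∷ os) = AllIntroduced P os
  AllIntroduced P (nrelabel _ _ _ ∷ os) = AllIntroduced P os

  allIntroduced-map : ∀ {k} {P Q : V → Set} → (∀ v → P v → Q v) → (os : List (NOp k)) →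
                      AllIntroduced P os → AllIntroduced Q os
  allIntroduced-map f [] _ = tt
  allIntroduced-map f (nintro v ℓ ∷ os) (p , ps) = f v p , allIntroduced-map f os ps
  allIntroduced-map f (njoin _ _ _ ∷ os) ps = allIntroduced-map f os ps
  allIntroduced-map f (nrelabel _ _ _ ∷ os) ps = allIntroduced-map f os ps

  allIntroduced-head : ∀ {k} {P : V → Set} o (os : List (NOp k)) → AllIntroduced P (o ∷ os) → AllIntroduced P (o ∷ [])
  allIntroduced-head (nintro v ℓ) os (p , _) = p , tt
  allIntroduced-head (njoin i j p) os _ = tt
  allIntroduced-head (nrelabel i j p) os _ = tt

  allIntroduced-tail : ∀ {k} {P : V → Set} o (os : List (NOp k)) → AllIntroduced P (o ∷ os) → AllIntroduced P os
  allIntroduced-tail (nintro v ℓ) os (_ , ps) = ps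
  allIntroduced-tail (njoin i j p) os ps = ps
  allIntroduced-tail (nrelabel i j p) os ps = ps

  present-step : ∀ {k} (σ : NState k) o v → Present σ v → Present (nstep σ o) v
  present-step σ (nintro u ℓ) v (b , e) with eqV v u
  ... | true = ℓ , refl
  ... | false = b , e
  present-step σ (njoin i j _) v p = p
  present-step σ (nrelabel i j _) v (b , e) rewrite e = renameLabel i j b , refl

  present-run : ∀ {k} (σ : NState k) os v → Present σ v → Present (nrun σ os) v
  present-run σ [] v p = p
  present-run σ (o ∷ os) v p = present-run (nstep σ o) os v (present-step σ o v p)

  introduced-present : ∀ {k} (σ : NState k) os → AllIntroduced (Present (nrun σ os)) os
  introduced-present σ [] = tt
  introduced-present σ (nintro v ℓ ∷ os) =
    present-run _ os v (ℓ , cong (λ b → if b then just ℓ else label σ v) (eqV-refl v)) , introduced-present _ os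
  introduced-present σ (njoin _ _ _ ∷ os) = introduced-present _ os
  introduced-present σ (nrelabel _ _ _ ∷ os) = introduced-present _ os

module OnVertices (G : Graph) where
  open Named (Fin (size G)) _≟_ public

  represents⇒iso : ∀ {k} (g : LGraph k) (σ : NState k) → Represents g σ →
                   (∀ v → Present σ v) → (∀ u w → edge σ u w ≡ adj G u w) → Iso g G
  represents⇒iso g σ r present edges = record
    { to = name ; from = from ; to-from = to-from ; from-to = from-to ; to-adj = to-adj }
    where
    open Represents r
    from : Fin (size G) → Fin (n g)
    from v = proj₁ (name-onto v (present v))
    to-from : ∀ x → name (from x) ≡ x
    to-from v = proj₂ (name-onto v (present v))
    from-to : ∀ x → from (name x) ≡ x
    from-to x = name-injective _ _ (to-from (name x))
    to-adj : ∀ x y → ladj g x y ≡ adj G (name x) (name y)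
    to-adj x y = trans (name-edge x y) (edges (name x) (name y))

-- Vertices of a given expression are named by the number of introductions preceding them.
module ByCounter where
  open Named ℕ ℕ._≟_ public

  annotate : ∀ {k} → ℕ → List (Op k) → List (NOp k)
  annotate c [] = []
  annotate c (intro ℓ ∷ os) = nintro c ℓ ∷ annotate (suc c) os
  annotate c (join i j p ∷ os) = njoin i j p ∷ annotate c os
  annotate c (relabel i j p ∷ os) = nrelabel i j p ∷ annotate c os

  erase-annotate : ∀ {k} c (os : List (Op k)) → map erase (annotate c os) ≡ os
  erase-annotate c [] = refl
  erase-annotate c (intro ℓ ∷ os) = cong (intro ℓ ∷_) (erase-annotate (suc c) os)
  erase-annotate c (join i j p ∷ os) = cong (join i j p ∷_) (erase-annotate c os)
  erase-annotate c (relabel i j p ∷ os) = cong (relabel i j p ∷_) (erase-annotate c os)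

  FreshFrom : ∀ {k} → ℕ → NState k → Set
  FreshFrom c σ = ∀ a → c ≤ a → Absent σ a

  annotate-valid : ∀ {k} c (σ : NState k) os → FreshFrom c σ → ValidOver (λ _ → true) σ (annotate c os)
  annotate-valid c σ [] fresh = tt
  annotate-valid c σ (intro ℓ ∷ os) fresh = refl , fresh c ≤-refl , annotate-valid (suc c) _ os fresh′
    where
    fresh′ : FreshFrom (suc c) (nstep σ (nintro c ℓ))
    fresh′ a le with a ℕ.≟ c
    ... | yes refl = ⊥-elim (<-irrefl refl le)
    ... | no _ = fresh a (≤-trans (n≤1+n c) le)
  annotate-valid c σ (join i j p ∷ os) fresh = annotate-valid c _ os fresh
  annotate-valid c σ (relabel i j p ∷ os) fresh = annotate-valid c _ os fresh′
    where
    fresh′ : FreshFrom c (nstep σ (nrelabel i j p))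
    fresh′ a le rewrite fresh a le = refl

  record NamedExpr (k : ℕ) (H : Graph) : Set where
    field
      nops            : List (NOp k)
      valid           : ValidOver (λ _ → true) nempty nops
      vertexOf        : ℕ → Fin (size H)
      nameOf          : Fin (size H) → ℕ
      vertexOf-nameOf : ∀ h → vertexOf (nameOf h) ≡ h
      edge-final      : ∀ h₁ h₂ → edge (nrun nempty nops) (nameOf h₁) (nameOf h₂) ≡ adj H h₁ h₂
      present-final   : ∀ h → Present (nrun nempty nops) (nameOf h)
      named-intros    : AllIntroduced (λ a → nameOf (vertexOf a) ≡ a) nops

  -- h₀ is only the junk value of vertexOf on names that are never introduced
  namedExpr : ∀ {k} (H : Graph) → Fin (size H) → (ops : List (Op k)) → Iso (run ops) H → NamedExpr k H
  namedExpr {k} H h₀ ops iso = record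
    { nops = nops ; valid = valid ; vertexOf = vertexOf ; nameOf = nameOf ; vertexOf-nameOf = vertexOf-nameOf
    ; edge-final = edge-final ; present-final = present-final ; named-intros = named-intros }
    where
    open Iso iso
    nops = annotate 0 ops
    valid : ValidOver (λ _ → true) nempty nops
    valid = annotate-valid 0 nempty ops (λ _ _ → refl)
    r : Represents (run ops) (nrun nempty nops)
    r = subst (λ os → Represents (foldl step emptyLG os) (nrun nempty nops)) (erase-annotate 0 ops)
              (represents-run emptyLG nempty nops represents-empty valid)
    open Represents r
    vertexOf : ℕ → Fin (size H)
    vertexOf a with any? (λ x → name x ℕ.≟ a)
    ... | yes (x , _) = to x
    ... | no _ = h₀
    nameOf : Fin (size H) → ℕ
    nameOf h = name (from h)
    vertexOf-name : ∀ x → nameOf (vertexOf (name x)) ≡ name x × vertexOf (name x) ≡ to x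
    vertexOf-name x with any? (λ y → name y ℕ.≟ name x)
    ... | yes (y , e) rewrite name-injective y x e | from-to x = refl , refl
    ... | no ne = ⊥-elim (ne (x , refl))
    vertexOf-nameOf : ∀ h → vertexOf (nameOf h) ≡ h
    vertexOf-nameOf h = trans (proj₂ (vertexOf-name (from h))) (to-from h)
    edge-final : ∀ h₁ h₂ → edge (nrun nempty nops) (nameOf h₁) (nameOf h₂) ≡ adj H h₁ h₂
    edge-final h₁ h₂ = trans (sym (name-edge (from h₁) (from h₂)))
                         (trans (to-adj (from h₁) (from h₂)) (cong₂ (adj H) (to-from h₁) (to-from h₂)))
    present-final : ∀ h → Present (nrun nempty nops) (nameOf h)
    present-final h = lab (run ops) (from h) , name-label (from h)
    named-intros : AllIntroduced (λ a → nameOf (vertexOf a) ≡ a) nops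
    named-intros = allIntroduced-map named nops (introduced-present nempty nops)
      where
      named : ∀ a → Present (nrun nempty nops) a → nameOf (vertexOf a) ≡ a
      named a p with name-onto a p
      ... | x , refl = proj₁ (vertexOf-name x)

-- Building induced subgraphs piece by piece

module Building (G : Graph) where
  open OnVertices G public

  Vx : Set
  Vx = Fin (size G)

  liftNOp : ∀ {k K} (f : Fin k → Fin K) → Injective _≡_ _≡_ f → NOp k → NOp K
  liftNOp f f-inj (nintro v ℓ) = nintro v (f ℓ)
  liftNOp f f-inj (njoin i j p) = njoin (f i) (f j) (λ e → p (f-inj e))
  liftNOp f f-inj (nrelabel i j p) = nrelabel (f i) (f j) (λ e → p (f-inj e))

  liftOps : ∀ {k K} (f : Fin k → Fin K) → Injective _≡_ _≡_ f → List (NOp k) → List (NOp K)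
  liftOps f f-inj = map (liftNOp f f-inj)

  -- replaying ops over S with labels renamed along f, on top of a state τ₀ that they cannot disturb
  module Lift {k K} (f : Fin k → Fin K) (f-inj : Injective _≡_ _≡_ f) (S : Vx → Bool) (τ₀ : NState K)
              (τ₀-avoids : ∀ v ℓ → label τ₀ v ≡ just ℓ → ∀ a → f a ≢ ℓ)
              (τ₀-fresh : ∀ v → S v ≡ true → Absent τ₀ v) where

    record Simulates (σ : NState k) (τ : NState K) : Set where
      field
        label-absent   : ∀ v → Absent σ v → label τ v ≡ label τ₀ v
        label-present  : ∀ v a → label σ v ≡ just a → label τ v ≡ just (f a)
        edge-present   : ∀ u w → Present σ u → Present σ w → edge τ u w ≡ edge σ u w
        edge-absent    : ∀ u w → Absent σ u → Absent σ w → edge τ u w ≡ edge τ₀ u w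
        edge-present-absent : ∀ u w → Present σ u → Absent σ w → edge τ u w ≡ false
        edge-absent-present : ∀ u w → Absent σ u → Present σ w → edge τ u w ≡ false

    simulates-empty : Simulates nempty τ₀
    simulates-empty = record
      { label-absent = λ _ _ → refl ; label-present = λ _ _ () ; edge-present = λ { _ _ (_ , ()) _ }
      ; edge-absent = λ _ _ _ _ → refl ; edge-present-absent = λ { _ _ (_ , ()) _ }
      ; edge-absent-present = λ { _ _ _ (_ , ()) } }

    hasLabel-simulated : ∀ {σ τ} → Simulates σ τ → ∀ u i → hasLabel (label τ u) (f i) ≡ hasLabel (label σ u) i
    hasLabel-simulated {σ} {τ} sim u i with label σ u in e
    ... | just a rewrite Simulates.label-present sim u a e = ==-injective f f-inj a i
    ... | nothing rewrite Simulates.label-absent sim u e with label τ₀ u in e₀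
    ...   | nothing = refl
    ...   | just ℓ = ==-≢ (λ q → τ₀-avoids u ℓ e₀ i (sym q))

    simulates-intro : ∀ {σ τ} v ℓ → Simulates σ τ → S v ≡ true → Absent σ v →
                      Simulates (nstep σ (nintro v ℓ)) (nstep τ (nintro v (f ℓ))) × Absent τ v
    simulates-intro {σ} {τ} v ℓ sim Sv absent =
      record { label-absent = l-abs ; label-present = l-pres ; edge-present = e-pp ; edge-absent = e-aa
             ; edge-present-absent = e-pa ; edge-absent-present = e-ap } ,
      trans (label-absent v absent) (τ₀-fresh v Sv)
      where
      open Simulates sim
      σ′ = nstep σ (nintro v ℓ)
      τ′ = nstep τ (nintro v (f ℓ))
      l-abs : ∀ u → Absent σ′ u → label τ′ u ≡ label τ₀ u
      l-abs u e with u ≟ v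
      l-abs u () | yes _
      ... | no _ = label-absent u e
      l-pres : ∀ u a → label σ′ u ≡ just a → label τ′ u ≡ just (f a)
      l-pres u a e with u ≟ v
      l-pres u a refl | yes _ = refl
      ... | no _ = label-present u a e
      e-pp : ∀ u w → Present σ′ u → Present σ′ w → edge τ′ u w ≡ edge σ′ u w
      e-pp u w pu pw with u ≟ v | w ≟ v
      ... | yes _ | _ = refl
      ... | no _ | yes _ = refl
      ... | no _ | no _ = edge-present u w pu pw
      e-aa : ∀ u w → Absent σ′ u → Absent σ′ w → edge τ′ u w ≡ edge τ₀ u w
      e-aa u w au aw with u ≟ v | w ≟ v
      e-aa u w () aw | yes _ | _
      e-aa u w au () | no _ | yes _
      ... | no _ | no _ = edge-absent u w au aw
      e-pa : ∀ u w → Present σ′ u → Absent σ′ w → edge τ′ u w ≡ false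
      e-pa u w pu aw with u ≟ v | w ≟ v
      ... | yes _ | _ = refl
      ... | no _ | yes _ = refl
      ... | no _ | no _ = edge-present-absent u w pu aw
      e-ap : ∀ u w → Absent σ′ u → Present σ′ w → edge τ′ u w ≡ false
      e-ap u w au pw with u ≟ v | w ≟ v
      ... | yes _ | _ = refl
      ... | no _ | yes _ = refl
      ... | no _ | no _ = edge-absent-present u w au pw

    simulates-join : ∀ {σ τ} i j p → Simulates σ τ →
                     Simulates (nstep σ (njoin i j p)) (nstep τ (liftNOp f f-inj (njoin i j p)))
    simulates-join {σ} {τ} i j p sim = record
      { label-absent = label-absent ; label-present = label-present ; edge-present = e-pp ; edge-absent = e-aa
      ; edge-present-absent = e-pa ; edge-absent-present = e-ap }
      where
      open Simulates sim
      σ′ = nstep σ (njoin i j p)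
      τ′ = nstep τ (liftNOp f f-inj (njoin i j p))
      e-pp : ∀ u w → Present σ′ u → Present σ′ w → edge τ′ u w ≡ edge σ′ u w
      e-pp u w pu pw rewrite hasLabel-simulated sim u i | hasLabel-simulated sim w j
                           | hasLabel-simulated sim u j | hasLabel-simulated sim w i | edge-present u w pu pw = refl
      e-aa : ∀ u w → Absent σ′ u → Absent σ′ w → edge τ′ u w ≡ edge τ₀ u w
      e-aa u w au aw rewrite hasLabel-simulated sim u i | hasLabel-simulated sim w j
                           | hasLabel-simulated sim u j | hasLabel-simulated sim w i
                           | edge-absent u w au aw | au = ∨-identityʳ _
      e-pa : ∀ u w → Present σ′ u → Absent σ′ w → edge τ′ u w ≡ false
      e-pa u w (b , eb) aw rewrite hasLabel-simulated sim u i | hasLabel-simulated sim w j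
                                 | hasLabel-simulated sim u j | hasLabel-simulated sim w i
                                 | edge-present-absent u w (b , eb) aw | eb | aw
                                 | ∧-zeroʳ (b == i) | ∧-zeroʳ (b == j) = refl
      e-ap : ∀ u w → Absent σ′ u → Present σ′ w → edge τ′ u w ≡ false
      e-ap u w au pw rewrite hasLabel-simulated sim u i | hasLabel-simulated sim w j
                           | hasLabel-simulated sim u j | hasLabel-simulated sim w i
                           | edge-absent-present u w au pw | au = refl

    simulates-relabel : ∀ {σ τ} i j p → Simulates σ τ →
                        Simulates (nstep σ (nrelabel i j p)) (nstep τ (liftNOp f f-inj (nrelabel i j p)))
    simulates-relabel {σ} {τ} i j p sim = record
      { label-absent = l-abs ; label-present = l-pres
      ; edge-present = λ u w pu pw → edge-present u w (pres u pu) (pres w pw)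
      ; edge-absent = λ u w au aw → edge-absent u w (abs u au) (abs w aw)
      ; edge-present-absent = λ u w pu aw → edge-present-absent u w (pres u pu) (abs w aw)
      ; edge-absent-present = λ u w au pw → edge-absent-present u w (abs u au) (pres w pw) }
      where
      open Simulates sim
      pres = present-relabel σ i j p
      abs = absent-relabel σ i j p
      l-abs : ∀ u → Maybe.map (renameLabel i j) (label σ u) ≡ nothing →
              Maybe.map (renameLabel (f i) (f j)) (label τ u) ≡ label τ₀ u
      l-abs u e with label σ u in eb
      ... | nothing rewrite label-absent u eb with label τ₀ u in e₀
      ...   | nothing = refl
      ...   | just ℓ = cong just (renameLabel-≢ (f i) (f j) ℓ (λ q → τ₀-avoids u ℓ e₀ i (sym q)))
      l-pres : ∀ u a → Maybe.map (renameLabel i j) (label σ u) ≡ just a →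
               Maybe.map (renameLabel (f i) (f j)) (label τ u) ≡ just (f a)
      l-pres u a e with label σ u in eb
      l-pres u a refl | just b rewrite label-present u b eb = cong just (renameLabel-natural f f-inj i j b)

    simulates-run : ∀ {σ τ} os → Simulates σ τ → ValidOver S σ os →
                    Simulates (nrun σ os) (nrun τ (liftOps f f-inj os)) × ValidOver S τ (liftOps f f-inj os)
    simulates-run [] sim _ = sim , tt
    simulates-run (nintro v ℓ ∷ os) sim (Sv , absent , val) with simulates-intro v ℓ sim Sv absent
    ... | sim′ , absent′ with simulates-run os sim′ val
    ...   | sim″ , val′ = sim″ , (Sv , absent′ , val′)
    simulates-run (njoin i j p ∷ os) sim val = simulates-run os (simulates-join i j p sim) val
    simulates-run (nrelabel i j p ∷ os) sim val = simulates-run os (simulates-relabel i j p sim) val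

  nrun-++ : ∀ {k} (σ : NState k) xs ys → nrun σ (xs ++ ys) ≡ nrun (nrun σ xs) ys
  nrun-++ = foldl-++ nstep

  valid-++ : ∀ {k} {S} (σ : NState k) xs ys → ValidOver S σ xs → ValidOver S (nrun σ xs) ys → ValidOver S σ (xs ++ ys)
  valid-++ σ [] ys _ v₂ = v₂
  valid-++ σ (nintro v ℓ ∷ xs) ys (s , a , v₁) v₂ = s , a , valid-++ _ xs ys v₁ v₂
  valid-++ σ (njoin _ _ _ ∷ xs) ys v₁ v₂ = valid-++ _ xs ys v₁ v₂
  valid-++ σ (nrelabel _ _ _ ∷ xs) ys v₁ v₂ = valid-++ _ xs ys v₁ v₂

  valid-mono : ∀ {k} {S S′ : Vx → Bool} (σ : NState k) xs → S ⊆ S′ → ValidOver S σ xs → ValidOver S′ σ xs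
  valid-mono σ [] _ _ = tt
  valid-mono σ (nintro v ℓ ∷ xs) sub (s , a , val) = sub v s , a , valid-mono _ xs sub val
  valid-mono σ (njoin _ _ _ ∷ xs) sub val = valid-mono _ xs sub val
  valid-mono σ (nrelabel _ _ _ ∷ xs) sub val = valid-mono _ xs sub val

  valid-absent : ∀ {k} {S : Vx → Bool} (σ : NState k) xs v → ValidOver S σ xs → Absent σ v → S v ≡ false →
                 Absent (nrun σ xs) v
  valid-absent σ [] v _ a _ = a
  valid-absent σ (nintro u ℓ ∷ xs) v (Su , _ , val) a s = valid-absent _ xs v val a′ s
    where
    a′ : Absent (nstep σ (nintro u ℓ)) v
    a′ with v ≟ u
    ... | yes refl = ⊥-elim (true≢false (trans (sym Su) s))
    ... | no _ = a
  valid-absent σ (njoin _ _ _ ∷ xs) v val a s = valid-absent _ xs v val a s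
  valid-absent σ (nrelabel i j p ∷ xs) v val a s = valid-absent _ xs v val (cong (Maybe.map (renameLabel i j)) a) s

  relabelAll : ∀ {k K} → (Fin k → Fin K) → Fin K → List (NOp K)
  relabelAll {zero} f ℓ = []
  relabelAll {suc k} f ℓ with f zero ≟ ℓ
  ... | yes _ = relabelAll (λ a → f (suc a)) ℓ
  ... | no p = nrelabel (f zero) ℓ p ∷ relabelAll (λ a → f (suc a)) ℓ

  relabelAll-valid : ∀ {k K} {S} (f : Fin k → Fin K) ℓ (τ : NState K) → ValidOver S τ (relabelAll f ℓ)
  relabelAll-valid {zero} f ℓ τ = tt
  relabelAll-valid {suc k} f ℓ τ with f zero ≟ ℓ
  ... | yes _ = relabelAll-valid (λ a → f (suc a)) ℓ τ
  ... | no p = relabelAll-valid (λ a → f (suc a)) ℓ _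

  relabelAll-edge : ∀ {k K} (f : Fin k → Fin K) ℓ (τ : NState K) u w → edge (nrun τ (relabelAll f ℓ)) u w ≡ edge τ u w
  relabelAll-edge {zero} f ℓ τ u w = refl
  relabelAll-edge {suc k} f ℓ τ u w with f zero ≟ ℓ
  ... | yes _ = relabelAll-edge (λ a → f (suc a)) ℓ τ u w
  ... | no p = relabelAll-edge (λ a → f (suc a)) ℓ _ u w

  relabelAll-absent : ∀ {k K} (f : Fin k → Fin K) ℓ (τ : NState K) u → Absent τ u → Absent (nrun τ (relabelAll f ℓ)) u
  relabelAll-absent {zero} f ℓ τ u e = e
  relabelAll-absent {suc k} f ℓ τ u e with f zero ≟ ℓ
  ... | yes _ = relabelAll-absent (λ a → f (suc a)) ℓ τ u e
  ... | no p = relabelAll-absent (λ a → f (suc a)) ℓ _ u (cong (Maybe.map (renameLabel (f zero) ℓ)) e)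

  relabelAll-keep : ∀ {k K} (f : Fin k → Fin K) ℓ (τ : NState K) u c → label τ u ≡ just c → (∀ a → f a ≢ c) →
                    label (nrun τ (relabelAll f ℓ)) u ≡ just c
  relabelAll-keep {zero} f ℓ τ u c e h = e
  relabelAll-keep {suc k} f ℓ τ u c e h with f zero ≟ ℓ
  ... | yes _ = relabelAll-keep (λ a → f (suc a)) ℓ τ u c e (λ a → h (suc a))
  ... | no p = relabelAll-keep (λ a → f (suc a)) ℓ _ u c e′ (λ a → h (suc a))
    where
    e′ : Maybe.map (renameLabel (f zero) ℓ) (label τ u) ≡ just c
    e′ rewrite e = cong just (renameLabel-≢ (f zero) ℓ c (λ q → h zero (sym q)))

  relabelAll-to : ∀ {k K} (f : Fin k → Fin K) ℓ (τ : NState K) u c → label τ u ≡ just c →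
                  (c ≡ ℓ ⊎ Σ (Fin k) λ a → f a ≡ c) → label (nrun τ (relabelAll f ℓ)) u ≡ just ℓ
  relabelAll-to {zero} f ℓ τ u c e (inj₁ refl) = e
  relabelAll-to {suc k} f ℓ τ u c e h with f zero ≟ ℓ
  relabelAll-to {suc k} f ℓ τ u c e (inj₁ q) | yes _ = relabelAll-to (λ a → f (suc a)) ℓ τ u c e (inj₁ q)
  relabelAll-to {suc k} f ℓ τ u c e (inj₂ (zero , q)) | yes r = relabelAll-to (λ a → f (suc a)) ℓ τ u c e (inj₁ (trans (sym q) r))
  relabelAll-to {suc k} f ℓ τ u c e (inj₂ (suc a , q)) | yes _ = relabelAll-to (λ a → f (suc a)) ℓ τ u c e (inj₂ (a , q))
  ... | no p with c ≟ f zero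
  ...   | yes q = relabelAll-to (λ a → f (suc a)) ℓ _ u ℓ e′ (inj₁ refl)
    where
    e′ : Maybe.map (renameLabel (f zero) ℓ) (label τ u) ≡ just ℓ
    e′ rewrite e with c ≟ f zero
    ... | yes _ = refl
    ... | no ne = ⊥-elim (ne q)
  ...   | no ne = relabelAll-to (λ a → f (suc a)) ℓ _ u c e′ (shift h)
    where
    e′ : Maybe.map (renameLabel (f zero) ℓ) (label τ u) ≡ just c
    e′ rewrite e = cong just (renameLabel-≢ (f zero) ℓ c ne)
    shift : (c ≡ ℓ ⊎ Σ (Fin (suc k)) λ a → f a ≡ c) → c ≡ ℓ ⊎ Σ _ λ a → f (suc a) ≡ c
    shift (inj₁ q) = inj₁ q
    shift (inj₂ (zero , q)) = ⊥-elim (ne (sym q))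
    shift (inj₂ (suc a , q)) = inj₂ (a , q)

  joinAll : ∀ {k K} → (Fin k → Fin K) → Fin K → List (NOp K)
  joinAll {zero} f ℓ = []
  joinAll {suc k} f ℓ with f zero ≟ ℓ
  ... | yes _ = joinAll (λ a → f (suc a)) ℓ
  ... | no p = njoin (f zero) ℓ p ∷ joinAll (λ a → f (suc a)) ℓ

  joinAll-valid : ∀ {k K} {S} (f : Fin k → Fin K) ℓ (τ : NState K) → ValidOver S τ (joinAll f ℓ)
  joinAll-valid {zero} f ℓ τ = tt
  joinAll-valid {suc k} f ℓ τ with f zero ≟ ℓ
  ... | yes _ = joinAll-valid (λ a → f (suc a)) ℓ τ
  ... | no p = joinAll-valid (λ a → f (suc a)) ℓ _

  joinAll-label : ∀ {k K} (f : Fin k → Fin K) ℓ (τ : NState K) u → label (nrun τ (joinAll f ℓ)) u ≡ label τ u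
  joinAll-label {zero} f ℓ τ u = refl
  joinAll-label {suc k} f ℓ τ u with f zero ≟ ℓ
  ... | yes _ = joinAll-label (λ a → f (suc a)) ℓ τ u
  ... | no p = joinAll-label (λ a → f (suc a)) ℓ _ u

  joinAll-mono : ∀ {k K} (f : Fin k → Fin K) ℓ (τ : NState K) u w → edge τ u w ≡ true →
                 edge (nrun τ (joinAll f ℓ)) u w ≡ true
  joinAll-mono {zero} f ℓ τ u w e = e
  joinAll-mono {suc k} f ℓ τ u w e with f zero ≟ ℓ
  ... | yes _ = joinAll-mono (λ a → f (suc a)) ℓ τ u w e
  ... | no p = joinAll-mono (λ a → f (suc a)) ℓ _ u w e′
    where
    e′ : edge (nstep τ (njoin (f zero) ℓ p)) u w ≡ true
    e′ rewrite e = refl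

  joinAll-joins : ∀ {k K} (f : Fin k → Fin K) ℓ (τ : NState K) u w a → label τ u ≡ just (f a) → label τ w ≡ just ℓ →
                  f a ≢ ℓ → edge (nrun τ (joinAll f ℓ)) u w ≡ true × edge (nrun τ (joinAll f ℓ)) w u ≡ true
  joinAll-joins {suc k} f ℓ τ u w a eu ew ne with f zero ≟ ℓ
  joinAll-joins {suc k} f ℓ τ u w zero eu ew ne | yes q = ⊥-elim (ne q)
  joinAll-joins {suc k} f ℓ τ u w (suc a) eu ew ne | yes _ = joinAll-joins (λ a → f (suc a)) ℓ τ u w a eu ew ne
  joinAll-joins {suc k} f ℓ τ u w zero eu ew ne | no p =
    joinAll-mono (λ a → f (suc a)) ℓ _ u w e₁ , joinAll-mono (λ a → f (suc a)) ℓ _ w u e₂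
    where
    e₁ : edge (nstep τ (njoin (f zero) ℓ p)) u w ≡ true
    e₁ rewrite eu | ew | ==-refl (f zero) | ==-refl ℓ = ∨-zeroʳ _
    e₂ : edge (nstep τ (njoin (f zero) ℓ p)) w u ≡ true
    e₂ rewrite eu | ew | ==-refl (f zero) | ==-refl ℓ | ==-≢ {a = ℓ} (λ q → p (sym q)) = ∨-zeroʳ _
  joinAll-joins {suc k} f ℓ τ u w (suc a) eu ew ne | no p = joinAll-joins (λ a → f (suc a)) ℓ _ u w a eu ew ne

  joinAll-edge-≢ℓ : ∀ {k K} (f : Fin k → Fin K) ℓ (τ : NState K) u w → label τ u ≢ just ℓ → label τ w ≢ just ℓ →
                    edge (nrun τ (joinAll f ℓ)) u w ≡ edge τ u w
  joinAll-edge-≢ℓ {zero} f ℓ τ u w nu nw = refl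
  joinAll-edge-≢ℓ {suc k} f ℓ τ u w nu nw with f zero ≟ ℓ
  ... | yes _ = joinAll-edge-≢ℓ (λ a → f (suc a)) ℓ τ u w nu nw
  ... | no p = trans (joinAll-edge-≢ℓ (λ a → f (suc a)) ℓ _ u w nu nw) e
    where
    e : edge (nstep τ (njoin (f zero) ℓ p)) u w ≡ edge τ u w
    e rewrite hasLabel-≢ (label τ u) ℓ nu | hasLabel-≢ (label τ w) ℓ nw
            | ∧-zeroʳ (hasLabel (label τ u) (f zero)) = ∨-identityʳ _

  joinAll-edge-∉image : ∀ {k K} (f : Fin k → Fin K) ℓ (τ : NState K) u w → (∀ a → label τ u ≢ just (f a)) →
                        (∀ a → label τ w ≢ just (f a)) → edge (nrun τ (joinAll f ℓ)) u w ≡ edge τ u w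
  joinAll-edge-∉image {zero} f ℓ τ u w nu nw = refl
  joinAll-edge-∉image {suc k} f ℓ τ u w nu nw with f zero ≟ ℓ
  ... | yes _ = joinAll-edge-∉image (λ a → f (suc a)) ℓ τ u w (λ a → nu (suc a)) (λ a → nw (suc a))
  ... | no p = trans (joinAll-edge-∉image (λ a → f (suc a)) ℓ _ u w (λ a → nu (suc a)) (λ a → nw (suc a))) e
    where
    e : edge (nstep τ (njoin (f zero) ℓ p)) u w ≡ edge τ u w
    e rewrite hasLabel-≢ (label τ u) (f zero) (nu zero) | hasLabel-≢ (label τ w) (f zero) (nw zero)
            | ∧-zeroʳ (hasLabel (label τ u) ℓ) = ∨-identityʳ _

  joinIf : ∀ {k K} → Bool → (Fin k → Fin K) → Fin K → List (NOp K)
  joinIf true f ℓ = joinAll f ℓ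
  joinIf false f ℓ = []

  joinIf-valid : ∀ {k K} {S} b (f : Fin k → Fin K) ℓ (τ : NState K) → ValidOver S τ (joinIf b f ℓ)
  joinIf-valid true = joinAll-valid
  joinIf-valid false _ _ _ = tt

  joinIf-label : ∀ {k K} b (f : Fin k → Fin K) ℓ (τ : NState K) u → label (nrun τ (joinIf b f ℓ)) u ≡ label τ u
  joinIf-label true = joinAll-label
  joinIf-label false _ _ _ _ = refl

  joinIf-edge-≢ℓ : ∀ {k K} b (f : Fin k → Fin K) ℓ (τ : NState K) u w → label τ u ≢ just ℓ → label τ w ≢ just ℓ →
                   edge (nrun τ (joinIf b f ℓ)) u w ≡ edge τ u w
  joinIf-edge-≢ℓ true = joinAll-edge-≢ℓ
  joinIf-edge-≢ℓ false _ _ _ _ _ _ _ = refl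

  joinIf-edge-∉image : ∀ {k K} b (f : Fin k → Fin K) ℓ (τ : NState K) u w → (∀ a → label τ u ≢ just (f a)) →
                       (∀ a → label τ w ≢ just (f a)) → edge (nrun τ (joinIf b f ℓ)) u w ≡ edge τ u w
  joinIf-edge-∉image true = joinAll-edge-∉image
  joinIf-edge-∉image false _ _ _ _ _ _ _ = refl

  record Builder (S : Vx → Bool) (k : ℕ) : Set where
    field
      ops     : List (NOp k)
      valid   : ValidOver S nempty ops
      present : ∀ v → S v ≡ true → Present (nrun nempty ops) v
      edges   : ∀ u w → S u ≡ true → S w ≡ true → edge (nrun nempty ops) u w ≡ adj G u w

  builder⇒linExpr : ∀ {k} → Builder (λ _ → true) k → HasLinExpr k G
  builder⇒linExpr b =
    map erase ops ,
    represents⇒iso _ _ (represents-run emptyLG nempty ops represents-empty valid)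
                   (λ v → present v refl) (λ u w → edges u w refl refl)
    where open Builder b

  record Placed {k K} (S : Vx → Bool) (f : Fin k → Fin K) (τ₀ τ₁ : NState K) : Set where
    field
      placed-label    : ∀ v → S v ≡ true → Σ (Fin k) λ a → label τ₁ v ≡ just (f a)
      untouched-label : ∀ v → S v ≡ false → label τ₁ v ≡ label τ₀ v
      placed-edge     : ∀ u w → S u ≡ true → S w ≡ true → edge τ₁ u w ≡ adj G u w
      untouched-edge  : ∀ u w → S u ≡ false → S w ≡ false → edge τ₁ u w ≡ edge τ₀ u w
      cross-edgeˡ     : ∀ u w → S u ≡ true → S w ≡ false → edge τ₁ u w ≡ false
      cross-edgeʳ     : ∀ u w → S u ≡ false → S w ≡ true → edge τ₁ u w ≡ false

  place : ∀ {k K} {S : Vx → Bool} (B : Builder S k) (f : Fin k → Fin K) (f-inj : Injective _≡_ _≡_ f) (τ₀ : NState K) →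
          (∀ v ℓ → label τ₀ v ≡ just ℓ → ∀ a → f a ≢ ℓ) → (∀ v → S v ≡ true → Absent τ₀ v) →
          Placed S f τ₀ (nrun τ₀ (liftOps f f-inj (Builder.ops B))) × ValidOver S τ₀ (liftOps f f-inj (Builder.ops B))
  place {S = S} B f f-inj τ₀ avoids fresh =
    record { placed-label = p-label ; untouched-label = λ v s → label-absent v (absent v s)
           ; placed-edge = λ u w su sw → trans (edge-present u w (present u su) (present w sw)) (edges u w su sw)
           ; untouched-edge = λ u w su sw → edge-absent u w (absent u su) (absent w sw)
           ; cross-edgeˡ = λ u w su sw → edge-present-absent u w (present u su) (absent w sw)
           ; cross-edgeʳ = λ u w su sw → edge-absent-present u w (absent u su) (present w sw) } ,
    proj₂ simulated
    where
    open Builder B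
    open Lift f f-inj S τ₀ avoids fresh
    simulated = simulates-run ops simulates-empty valid
    open Simulates (proj₁ simulated)
    absent : ∀ v → S v ≡ false → Absent (nrun nempty ops) v
    absent v s = valid-absent nempty ops v valid refl s
    p-label : ∀ v → S v ≡ true → Σ _ λ a → _
    p-label v s with present v s
    ... | a , e = a , label-present v a e

  emptyBuilder : ∀ {k} (S : Vx → Bool) → (∀ v → S v ≡ false) → Builder S k
  emptyBuilder S none = record
    { ops = [] ; valid = tt ; present = λ v s → ⊥-elim (true≢false (trans (sym s) (none v)))
    ; edges = λ u w s _ → ⊥-elim (true≢false (trans (sym s) (none u))) }

  singletonBuilder : ∀ {k} (S : Vx → Bool) v₀ → S v₀ ≡ true → (∀ v → S v ≡ true → v ≡ v₀) → Builder S (suc k)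
  singletonBuilder {k} S v₀ s₀ only = record
    { ops = nintro v₀ zero ∷ [] ; valid = s₀ , refl , tt ; present = pres ; edges = edges }
    where
    pres : ∀ v → S v ≡ true → Present (nrun (nempty {suc k}) (nintro v₀ zero ∷ [])) v
    pres v s with only v s
    ... | refl rewrite eqV-refl v = zero , refl
    edges : ∀ u w → S u ≡ true → S w ≡ true → edge (nrun (nempty {suc k}) (nintro v₀ zero ∷ [])) u w ≡ adj G u w
    edges u w su sw with only u su | only w sw
    ... | refl | refl rewrite eqV-refl u = sym (irrefl G u)

  -- G[S] is the union (jn = false) or join (jn = true) of G[A] and G[B]: build A, collapse
  -- its labels to 0, build B on labels 1..K, join B to label 0 if jn, collapse B to 0.
  module Combine {kA kB K : ℕ} (A B S : Vx → Bool) (jn : Bool)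
    (disjoint : ∀ v → A v ≡ true → B v ≡ false)
    (cover : ∀ v → S v ≡ true → A v ≡ true ⊎ B v ≡ true)
    (A⊆S : A ⊆ S) (B⊆S : B ⊆ S)
    (across : ∀ u w → A u ≡ true → B w ≡ true → adj G u w ≡ jn)
    (bA : Builder A kA) (bB : Builder B kB) (kA≤ : kA ≤ suc K) (kB≤ : kB ≤ K) where

    fA : Fin kA → Fin (suc K)
    fA a = inject≤ a kA≤
    fA-inj : Injective _≡_ _≡_ fA
    fA-inj = inject≤-injective kA≤ kA≤ _ _
    fB : Fin kB → Fin (suc K)
    fB b = suc (inject≤ b kB≤)
    fB-inj : Injective _≡_ _≡_ fB
    fB-inj e = inject≤-injective kB≤ kB≤ _ _ (suc-injective e)

    opsA = liftOps fA fA-inj (Builder.ops bA)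
    opsB = liftOps fB fB-inj (Builder.ops bB)
    τ₁ = nrun nempty opsA
    τ₂ = nrun τ₁ (relabelAll fA zero)
    τ₃ = nrun τ₂ opsB
    τ₄ = nrun τ₃ (joinIf jn fB zero)
    τ₅ = nrun τ₄ (relabelAll fB zero)
    allOps = opsA ++ (relabelAll fA zero ++ (opsB ++ (joinIf jn fB zero ++ relabelAll fB zero)))

    allOps-run : nrun nempty allOps ≡ τ₅
    allOps-run = trans (nrun-++ nempty opsA _) (trans (nrun-++ τ₁ (relabelAll fA zero) _)
                   (trans (nrun-++ τ₂ opsB _) (nrun-++ τ₃ (joinIf jn fB zero) _)))

    placedA = place bA fA fA-inj nempty (λ _ _ ()) (λ _ _ → refl)
    module PA = Placed (proj₁ placedA)

    τ₂-A : ∀ v → A v ≡ true → label τ₂ v ≡ just zero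
    τ₂-A v s with PA.placed-label v s
    ... | a , e = relabelAll-to fA zero τ₁ v (fA a) e (inj₂ (a , refl))
    τ₂-¬A : ∀ v → A v ≡ false → Absent τ₂ v
    τ₂-¬A v s = relabelAll-absent fA zero τ₁ v (PA.untouched-label v s)

    τ₂-avoids : ∀ v ℓ → label τ₂ v ≡ just ℓ → ∀ b → fB b ≢ ℓ
    τ₂-avoids v ℓ e b q with A v in eA
    ... | true with trans (sym e) (τ₂-A v eA)
    ...   | refl with q
    ...     | ()
    τ₂-avoids v ℓ e b q | false with trans (sym e) (τ₂-¬A v eA)
    ... | ()
    B⇒¬A : ∀ v → B v ≡ true → A v ≡ false
    B⇒¬A v s with A v in eA
    ... | true = ⊥-elim (true≢false (trans (sym s) (disjoint v eA)))
    ... | false = refl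
    placedB = place bB fB fB-inj τ₂ τ₂-avoids (λ v s → τ₂-¬A v (B⇒¬A v s))
    module PB = Placed (proj₁ placedB)

    τ₃-A : ∀ v → A v ≡ true → label τ₃ v ≡ just zero
    τ₃-A v s = trans (PB.untouched-label v (disjoint v s)) (τ₂-A v s)

    present-final : ∀ v → S v ≡ true → Present τ₅ v
    present-final v s with cover v s
    ... | inj₁ a = zero , relabelAll-to fB zero τ₄ v zero (trans (joinIf-label jn fB zero τ₃ v) (τ₃-A v a)) (inj₁ refl)
    ... | inj₂ b with PB.placed-label v b
    ...   | c , e = zero , relabelAll-to fB zero τ₄ v (fB c) (trans (joinIf-label jn fB zero τ₃ v) e) (inj₂ (c , refl))

    fB≢0 : ∀ {b} {c : Fin K} → label τ₃ b ≡ just (suc c) → label τ₃ b ≢ just zero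
    fB≢0 e e′ with trans (sym e) e′
    ... | ()

    A-not-fB : ∀ v → A v ≡ true → ∀ c → label τ₃ v ≢ just (fB c)
    A-not-fB v a c e with trans (sym e) (τ₃-A v a)
    ... | ()

    edges-AA : ∀ u w → A u ≡ true → A w ≡ true → edge τ₄ u w ≡ adj G u w
    edges-AA u w a₁ a₂ = begin
      edge τ₄ u w   ≡⟨ joinIf-edge-∉image jn fB zero τ₃ u w (A-not-fB u a₁) (A-not-fB w a₂) ⟩
      edge τ₃ u w   ≡⟨ PB.untouched-edge u w (disjoint u a₁) (disjoint w a₂) ⟩
      edge τ₂ u w   ≡⟨ relabelAll-edge fA zero τ₁ u w ⟩
      edge τ₁ u w   ≡⟨ PA.placed-edge u w a₁ a₂ ⟩
      adj G u w     ∎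
      where open ≡-Reasoning
    edges-BB : ∀ u w → B u ≡ true → B w ≡ true → edge τ₄ u w ≡ adj G u w
    edges-BB u w b₁ b₂ with PB.placed-label u b₁ | PB.placed-label w b₂
    ... | _ , e₁ | _ , e₂ = trans (joinIf-edge-≢ℓ jn fB zero τ₃ u w (fB≢0 e₁) (fB≢0 e₂)) (PB.placed-edge u w b₁ b₂)
    edges-BA : ∀ b → jn ≡ b → ∀ u w → B u ≡ true → A w ≡ true →
               edge (nrun τ₃ (joinIf b fB zero)) u w ≡ adj G u w × edge (nrun τ₃ (joinIf b fB zero)) w u ≡ adj G w u
    edges-BA true refl u w b a with PB.placed-label u b
    ... | c , e with joinAll-joins fB zero τ₃ u w c e (τ₃-A w a) (λ ())
    ...   | j₁ , j₂ = trans j₁ (sym (trans (Graph.sym G u w) (across w u a b))) , trans j₂ (sym (across w u a b))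
    edges-BA false refl u w b a =
      trans (PB.cross-edgeˡ u w b (disjoint w a)) (sym (trans (Graph.sym G u w) (across w u a b))) ,
      trans (PB.cross-edgeʳ w u (disjoint w a) b) (sym (across w u a b))

    edges-final : ∀ u w → S u ≡ true → S w ≡ true → edge τ₅ u w ≡ adj G u w
    edges-final u w su sw = trans (relabelAll-edge fB zero τ₄ u w) (by-parts (cover u su) (cover w sw))
      where
      by-parts : _ → _ → edge τ₄ u w ≡ adj G u w
      by-parts (inj₁ a₁) (inj₁ a₂) = edges-AA u w a₁ a₂
      by-parts (inj₂ b₁) (inj₂ b₂) = edges-BB u w b₁ b₂
      by-parts (inj₂ b₁) (inj₁ a₂) = proj₁ (edges-BA jn refl u w b₁ a₂)
      by-parts (inj₁ a₁) (inj₂ b₂) = proj₂ (edges-BA jn refl w u b₂ a₁)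

    valid : ValidOver S nempty allOps
    valid = valid-++ nempty opsA _ (valid-mono nempty opsA A⊆S (proj₂ placedA))
              (valid-++ τ₁ (relabelAll fA zero) _ (relabelAll-valid fA zero τ₁)
              (valid-++ τ₂ opsB _ (valid-mono τ₂ opsB B⊆S (proj₂ placedB))
              (valid-++ τ₃ (joinIf jn fB zero) _ (joinIf-valid jn fB zero τ₃) (relabelAll-valid fB zero τ₄))))

    combined : Builder S (suc K)
    combined = record
      { ops = allOps ; valid = valid
      ; present = λ v s → subst (λ τ → Present τ v) (sym allOps-run) (present-final v s)
      ; edges = λ u w su sw → subst (λ τ → edge τ u w ≡ adj G u w) (sym allOps-run) (edges-final u w su sw) }

-- Modular partitions and substitution

module Quotients (G : Graph) where
  module H = ByCounter
  open Building G

  record ModularPartition (S : Vx → Bool) : Set where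
    field
      classes     : ℕ
      rep         : Fin classes → Vx
      classOf     : Vx → Fin classes
      rep∈S       : ∀ h → S (rep h) ≡ true
      classOf-rep : ∀ h → classOf (rep h) ≡ h
      adj-across  : ∀ u w → S u ≡ true → S w ≡ true → classOf u ≢ classOf w →
                    adj G u w ≡ adj G (rep (classOf u)) (rep (classOf w))

  quotient : ∀ {S} → ModularPartition S → Graph
  quotient mp = record
    { size = classes ; adj = λ a b → adj G (rep a) (rep b)
    ; sym = λ a b → Graph.sym G (rep a) (rep b) ; irrefl = λ a → irrefl G (rep a) }
    where open ModularPartition mp

  module _ {S : Vx → Bool} (mp : ModularPartition S) where
    open ModularPartition mp

    Class : Fin classes → Vx → Bool
    Class h v = S v ∧ (classOf v == h)

    Class-intro : ∀ h v → S v ≡ true → classOf v ≡ h → Class h v ≡ true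
    Class-intro h v s refl rewrite s = ==-refl (classOf v)

    Class-other : ∀ h v → classOf v ≢ h → Class h v ≡ false
    Class-other h v ne with S v
    ... | true = ==-≢ ne
    ... | false = refl

    Class-outside : ∀ h v → S v ≡ false → Class h v ≡ false
    Class-outside h v s rewrite s = refl

    Class-elim : ∀ h v → Class h v ≡ true → S v ≡ true × classOf v ≡ h
    Class-elim h v e with S v
    ... | true = refl , ==-≡ e

    Class⊆S : ∀ h → Class h ⊆ S
    Class⊆S h v e = proj₁ (Class-elim h v e)

    rep∈Class : ∀ h → Class h (rep h) ≡ true
    rep∈Class h = Class-intro h (rep h) (rep∈S h) (classOf-rep h)

    adj-between-classes : ∀ a b u w → Class a u ≡ true → Class b w ≡ true → a ≢ b → adj G u w ≡ adj G (rep a) (rep b)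
    adj-between-classes a b u w cu cw a≢b with Class-elim a u cu | Class-elim b w cw
    ... | su , refl | sw , refl = adj-across u w su sw a≢b

  -- Labels 0 … kH−1 are the quotient's, kH (ℓF) holds the class hF, which is built first and
  -- collapsed, and kH+1 … kH+k₂ are scratch labels for building each remaining class at the
  -- moment the quotient expression introduces it.
  module Substitute {S : Vx → Bool} (mp : ModularPartition S) {kH : ℕ} (he : H.NamedExpr kH (quotient mp))
                    (hF : Fin (ModularPartition.classes mp)) {k₁ k₂ K : ℕ} (bF : Builder (Class mp hF) k₁)
                    (bRest : ∀ h → h ≢ hF → Builder (Class mp h) k₂) (k₁≤K : k₁ ≤ K) (room : kH + suc k₂ ≤ K) where
    open ModularPartition mp
    open H.NamedExpr he

    kH<K : kH < K
    kH<K = ≤-trans (m<m+n kH (s≤s z≤n)) room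

    ι : Fin kH → Fin K
    ι c = fromℕ< (<-trans (toℕ<n c) kH<K)
    ℓF : Fin K
    ℓF = fromℕ< kH<K
    fC : Fin k₂ → Fin K
    fC b = fromℕ< (<-≤-trans (+-monoʳ-< kH (s≤s (toℕ<n b))) room)
    fF : Fin k₁ → Fin K
    fF a = inject≤ a k₁≤K

    toℕ-ι : ∀ c → toℕ (ι c) ≡ toℕ c
    toℕ-ι c = toℕ-fromℕ< _
    toℕ-ℓF : toℕ ℓF ≡ kH
    toℕ-ℓF = toℕ-fromℕ< _
    toℕ-fC : ∀ b → toℕ (fC b) ≡ kH + suc (toℕ b)
    toℕ-fC b = toℕ-fromℕ< _

    ι-inj : Injective _≡_ _≡_ ι
    ι-inj {a} {b} e = toℕ-injective (trans (sym (toℕ-ι a)) (trans (cong toℕ e) (toℕ-ι b)))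
    fC-inj : Injective _≡_ _≡_ fC
    fC-inj {a} {b} e = toℕ-injective (ℕ-suc-injective (+-cancelˡ-≡ kH _ _ (trans (sym (toℕ-fC a)) (trans (cong toℕ e) (toℕ-fC b)))))
    fF-inj : Injective _≡_ _≡_ fF
    fF-inj = inject≤-injective k₁≤K k₁≤K _ _

    ι≢ℓF : ∀ c → ι c ≢ ℓF
    ι≢ℓF c e = <⇒≢ (toℕ<n c) (trans (sym (toℕ-ι c)) (trans (cong toℕ e) toℕ-ℓF))
    ι≢fC : ∀ c b → ι c ≢ fC b
    ι≢fC c b e = <⇒≢ (<-≤-trans (toℕ<n c) (m≤m+n kH (suc (toℕ b)))) (trans (sym (toℕ-ι c)) (trans (cong toℕ e) (toℕ-fC b)))
    fC≢ℓF : ∀ b → fC b ≢ ℓF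
    fC≢ℓF b e = m+1+n≢m kH (trans (sym (toℕ-fC b)) (trans (cong toℕ e) toℕ-ℓF))

    ι-label-≢ℓF : ∀ (m : Maybe (Fin kH)) → Maybe.map ι m ≢ just ℓF
    ι-label-≢ℓF (just c) e = ι≢ℓF c (just-injective e)
    ι-label-≢fC : ∀ (m : Maybe (Fin kH)) b → Maybe.map ι m ≢ just (fC b)
    ι-label-≢fC (just c) b e = ι≢fC c b (just-injective e)

    adjFirst : Fin classes → Bool
    adjFirst h = adj G (rep h) (rep hF)

    translate : H.NOp kH → List (NOp K)
    translate (H.nintro a c) with vertexOf a ≟ hF
    ... | yes _ = []
    ... | no ne = liftOps fC fC-inj (Builder.ops (bRest (vertexOf a) ne))
                  ++ (joinIf (adjFirst (vertexOf a)) fC ℓF ++ relabelAll fC (ι c))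
    translate (H.njoin i j p) = njoin (ι i) (ι j) (λ e → p (ι-inj e)) ∷ []
    translate (H.nrelabel i j p) = nrelabel (ι i) (ι j) (λ e → p (ι-inj e)) ∷ []

    translateAll : List (H.NOp kH) → List (NOp K)
    translateAll [] = []
    translateAll (o ∷ os) = translate o ++ translateAll os

    record Invariant (σ : H.NState kH) (τ : NState K) : Set where
      field
        label-rest      : ∀ v → S v ≡ true → classOf v ≢ hF → label τ v ≡ Maybe.map ι (H.label σ (nameOf (classOf v)))
        label-first     : ∀ v → S v ≡ true → classOf v ≡ hF → label τ v ≡ just ℓF
        label-outside   : ∀ v → S v ≡ false → Absent τ v
        edge-first      : ∀ u w → S u ≡ true → S w ≡ true → classOf u ≡ hF → classOf w ≡ hF → edge τ u w ≡ adj G u w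
        edge-quotient   : ∀ u w → S u ≡ true → S w ≡ true → classOf u ≢ hF → classOf w ≢ hF → classOf u ≢ classOf w →
                          edge τ u w ≡ H.edge σ (nameOf (classOf u)) (nameOf (classOf w))
        edge-same-class : ∀ u w → S u ≡ true → S w ≡ true → classOf u ≢ hF → classOf u ≡ classOf w →
                          H.Present σ (nameOf (classOf u)) → edge τ u w ≡ adj G u w
        edge-first-rest : ∀ u w → S u ≡ true → S w ≡ true → classOf u ≡ hF → classOf w ≢ hF →
                          H.Present σ (nameOf (classOf w)) → edge τ u w ≡ adj G u w × edge τ w u ≡ adj G w u

    opsF = liftOps fF fF-inj (Builder.ops bF)
    τStart = nrun (nrun nempty opsF) (relabelAll fF ℓF)

    placedF = place bF fF fF-inj nempty (λ _ _ ()) (λ _ _ → refl)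
    module PF = Placed (proj₁ placedF)

    invariant-start : Invariant H.nempty τStart
    invariant-start = record
      { label-rest = l-rest ; label-first = l-first ; label-outside = l-outside ; edge-first = e-first
      ; edge-quotient = e-quotient ; edge-same-class = λ { _ _ _ _ _ _ (_ , ()) } ; edge-first-rest = λ { _ _ _ _ _ _ (_ , ()) } }
      where
      l-rest : ∀ v → S v ≡ true → classOf v ≢ hF → Absent τStart v
      l-rest v s ne = relabelAll-absent fF ℓF _ v (PF.untouched-label v (Class-other mp hF v ne))
      l-first : ∀ v → S v ≡ true → classOf v ≡ hF → label τStart v ≡ just ℓF
      l-first v s e with PF.placed-label v (Class-intro mp hF v s e)
      ... | a , q = relabelAll-to fF ℓF _ v (fF a) q (inj₂ (a , refl))
      l-outside : ∀ v → S v ≡ false → Absent τStart v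
      l-outside v s = relabelAll-absent fF ℓF _ v (PF.untouched-label v (Class-outside mp hF v s))
      e-first : ∀ u w → S u ≡ true → S w ≡ true → classOf u ≡ hF → classOf w ≡ hF → edge τStart u w ≡ adj G u w
      e-first u w su sw eu ew =
        trans (relabelAll-edge fF ℓF _ u w) (PF.placed-edge u w (Class-intro mp hF u su eu) (Class-intro mp hF w sw ew))
      e-quotient : ∀ u w → S u ≡ true → S w ≡ true → classOf u ≢ hF → classOf w ≢ hF → classOf u ≢ classOf w →
                   edge τStart u w ≡ false
      e-quotient u w su sw nu nw _ =
        trans (relabelAll-edge fF ℓF _ u w) (PF.untouched-edge u w (Class-other mp hF u nu) (Class-other mp hF w nw))

    hasLabel-ι : ∀ (m : Maybe (Fin kH)) i → hasLabel (Maybe.map ι m) (ι i) ≡ hasLabel m i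
    hasLabel-ι nothing i = refl
    hasLabel-ι (just c) i = ==-injective ι ι-inj c i

    invariant-join : ∀ {σ τ} i j p → Invariant σ τ → Invariant (H.nstep σ (H.njoin i j p)) (nrun τ (translate (H.njoin i j p)))
    invariant-join {σ} {τ} i j p inv = record
      { label-rest = label-rest ; label-first = label-first ; label-outside = label-outside ; edge-first = e-first
      ; edge-quotient = e-quotient ; edge-same-class = e-same ; edge-first-rest = e-first-rest }
      where
      open Invariant inv
      q : ι i ≢ ι j
      q e = p (ι-inj e)
      τ′ = nstep τ (njoin (ι i) (ι j) q)
      σ′ = H.nstep σ (H.njoin i j p)
      first-unjoined : ∀ u w → S u ≡ true → classOf u ≡ hF → edge τ′ u w ≡ edge τ u w × edge τ′ w u ≡ edge τ w u
      first-unjoined u w su eu = join-ignores τ (ι i) (ι j) q u w ℓF (label-first u su eu) (λ e → ι≢ℓF i (sym e)) (λ e → ι≢ℓF j (sym e))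
      e-first : ∀ u w → S u ≡ true → S w ≡ true → classOf u ≡ hF → classOf w ≡ hF → edge τ′ u w ≡ adj G u w
      e-first u w su sw eu ew = trans (proj₁ (first-unjoined u w su eu)) (edge-first u w su sw eu ew)
      e-quotient : ∀ u w → S u ≡ true → S w ≡ true → classOf u ≢ hF → classOf w ≢ hF → classOf u ≢ classOf w →
                   edge τ′ u w ≡ H.edge σ′ (nameOf (classOf u)) (nameOf (classOf w))
      e-quotient u w su sw nu nw nuw
        rewrite label-rest u su nu | label-rest w sw nw
              | hasLabel-ι (H.label σ (nameOf (classOf u))) i | hasLabel-ι (H.label σ (nameOf (classOf w))) j
              | hasLabel-ι (H.label σ (nameOf (classOf u))) j | hasLabel-ι (H.label σ (nameOf (classOf w))) i
              | edge-quotient u w su sw nu nw nuw = refl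
      e-same : ∀ u w → S u ≡ true → S w ≡ true → classOf u ≢ hF → classOf u ≡ classOf w →
               H.Present σ′ (nameOf (classOf u)) → edge τ′ u w ≡ adj G u w
      e-same u w su sw nu euw pr = trans (join-same-label τ (ι i) (ι j) q u w same-label) (edge-same-class u w su sw nu euw pr)
        where
        same-label : label τ u ≡ label τ w
        same-label rewrite label-rest u su nu | label-rest w sw (λ e → nu (trans euw e)) | euw = refl
      e-first-rest : ∀ u w → S u ≡ true → S w ≡ true → classOf u ≡ hF → classOf w ≢ hF →
                     H.Present σ′ (nameOf (classOf w)) → edge τ′ u w ≡ adj G u w × edge τ′ w u ≡ adj G w u
      e-first-rest u w su sw eu nw pr =
        trans (proj₁ (first-unjoined u w su eu)) (proj₁ (edge-first-rest u w su sw eu nw pr)) ,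
        trans (proj₂ (first-unjoined u w su eu)) (proj₂ (edge-first-rest u w su sw eu nw pr))

    invariant-relabel : ∀ {σ τ} i j p → Invariant σ τ →
                        Invariant (H.nstep σ (H.nrelabel i j p)) (nrun τ (translate (H.nrelabel i j p)))
    invariant-relabel {σ} {τ} i j p inv = record
      { label-rest = l-rest ; label-first = l-first ; label-outside = l-outside
      ; edge-first = edge-first ; edge-quotient = edge-quotient
      ; edge-same-class = λ u w su sw nu e pr → edge-same-class u w su sw nu e (H.present-relabel σ i j p _ pr)
      ; edge-first-rest = λ u w su sw eu nw pr → edge-first-rest u w su sw eu nw (H.present-relabel σ i j p _ pr) }
      where
      open Invariant inv
      τ′ = nstep τ (nrelabel (ι i) (ι j) (λ e → p (ι-inj e)))
      σ′ = H.nstep σ (H.nrelabel i j p)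
      l-rest : ∀ v → S v ≡ true → classOf v ≢ hF → label τ′ v ≡ Maybe.map ι (H.label σ′ (nameOf (classOf v)))
      l-rest v s ne rewrite label-rest v s ne with H.label σ (nameOf (classOf v))
      ... | nothing = refl
      ... | just c = cong just (renameLabel-natural ι ι-inj i j c)
      l-first : ∀ v → S v ≡ true → classOf v ≡ hF → label τ′ v ≡ just ℓF
      l-first v s e rewrite label-first v s e = cong just (renameLabel-≢ (ι i) (ι j) ℓF (λ e → ι≢ℓF i (sym e)))
      l-outside : ∀ v → S v ≡ false → Absent τ′ v
      l-outside v s rewrite label-outside v s = refl

    nameOf-inverse : ∀ x a → nameOf x ≡ a → x ≡ vertexOf a
    nameOf-inverse x a e = trans (sym (vertexOf-nameOf x)) (cong vertexOf e)

    present-before-intro : ∀ (σ : H.NState kH) a c y → y ≢ a → H.Present (H.nstep σ (H.nintro a c)) y → H.Present σ y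
    present-before-intro σ a c y ne (b , e) = b , trans (sym (H.intro-label-≢ σ a c ne)) e

    invariant-skip : ∀ {σ τ} a c → vertexOf a ≡ hF → Invariant σ τ → Invariant (H.nstep σ (H.nintro a c)) τ
    invariant-skip {σ} {τ} a c e inv = record
      { label-rest = l-rest ; label-first = label-first ; label-outside = label-outside ; edge-first = edge-first
      ; edge-quotient = e-quotient ; edge-same-class = e-same ; edge-first-rest = e-first-rest }
      where
      open Invariant inv
      σ′ = H.nstep σ (H.nintro a c)
      not-a : ∀ v → classOf v ≢ hF → nameOf (classOf v) ≢ a
      not-a v ne q = ne (trans (nameOf-inverse (classOf v) a q) e)
      l-rest : ∀ v → S v ≡ true → classOf v ≢ hF → label τ v ≡ Maybe.map ι (H.label σ′ (nameOf (classOf v)))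
      l-rest v s ne rewrite H.intro-label-≢ σ a c (not-a v ne) = label-rest v s ne
      e-quotient : ∀ u w → S u ≡ true → S w ≡ true → classOf u ≢ hF → classOf w ≢ hF → classOf u ≢ classOf w →
                   edge τ u w ≡ H.edge σ′ (nameOf (classOf u)) (nameOf (classOf w))
      e-quotient u w su sw nu nw nuw rewrite H.intro-edge-≢ σ a c (not-a u nu) (not-a w nw) = edge-quotient u w su sw nu nw nuw
      e-same : ∀ u w → S u ≡ true → S w ≡ true → classOf u ≢ hF → classOf u ≡ classOf w →
               H.Present σ′ (nameOf (classOf u)) → edge τ u w ≡ adj G u w
      e-same u w su sw nu euw pr = edge-same-class u w su sw nu euw (present-before-intro σ a c _ (not-a u nu) pr)
      e-first-rest : ∀ u w → S u ≡ true → S w ≡ true → classOf u ≡ hF → classOf w ≢ hF →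
                     H.Present σ′ (nameOf (classOf w)) → edge τ u w ≡ adj G u w × edge τ w u ≡ adj G w u
      e-first-rest u w su sw eu nw pr = edge-first-rest u w su sw eu nw (present-before-intro σ a c _ (not-a w nw) pr)

    -- the quotient expression introduces a (named nameOf h) with label c: build class h on the
    -- scratch labels, join it to the first class if h is adjacent to it, then collapse it to ι c
    module IntroduceClass {σ : H.NState kH} {τ : NState K} (a : ℕ) (c : Fin kH) (h : Fin classes) (h≢hF : h ≢ hF)
                          (named : nameOf h ≡ a) (fresh : H.Absent σ a) (inv : Invariant σ τ) where
      open Invariant inv
      σ′ = H.nstep σ (H.nintro a c)
      opsH = liftOps fC fC-inj (Builder.ops (bRest h h≢hF))
      τ₁ = nrun τ opsH
      τ₂ = nrun τ₁ (joinIf (adjFirst h) fC ℓF)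
      τ₃ = nrun τ₂ (relabelAll fC (ι c))
      introOps = opsH ++ (joinIf (adjFirst h) fC ℓF ++ relabelAll fC (ι c))

      introOps-run : nrun τ introOps ≡ τ₃
      introOps-run = trans (nrun-++ τ opsH _) (nrun-++ τ₁ (joinIf (adjFirst h) fC ℓF) _)

      not-a : ∀ v → classOf v ≢ h → nameOf (classOf v) ≢ a
      not-a v ne q = ne (trans (nameOf-inverse (classOf v) a q) (trans (cong vertexOf (sym named)) (vertexOf-nameOf h)))

      hF≢h : hF ≢ h
      hF≢h e = h≢hF (sym e)

      first≢h : ∀ v → classOf v ≡ hF → classOf v ≢ h
      first≢h v e q = hF≢h (trans (sym e) q)

      avoids : ∀ v ℓ → label τ v ≡ just ℓ → ∀ b → fC b ≢ ℓ
      avoids v ℓ e b q with S v in es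
      ... | false with trans (sym e) (label-outside v es)
      ...   | ()
      avoids v ℓ e b q | true with classOf v ≟ hF
      ... | yes eh = fC≢ℓF b (trans q (just-injective (trans (sym e) (label-first v es eh))))
      ... | no nh = ι-label-≢fC (H.label σ (nameOf (classOf v))) b (trans (sym (label-rest v es nh)) (trans e (cong just (sym q))))

      class-absent : ∀ v → Class mp h v ≡ true → Absent τ v
      class-absent v e with Class-elim mp h v e
      ... | s , refl rewrite label-rest v s h≢hF | named | fresh = refl

      placedH = place (bRest h h≢hF) fC fC-inj τ avoids class-absent
      module P = Placed (proj₁ placedH)

      label-class : ∀ v → S v ≡ true → classOf v ≡ h → Σ (Fin k₂) λ b → label τ₁ v ≡ just (fC b)
      label-class v s e = P.placed-label v (Class-intro mp h v s e)
      label-other : ∀ v → classOf v ≢ h → label τ₁ v ≡ label τ v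
      label-other v n = P.untouched-label v (Class-other mp h v n)

      l-rest : ∀ v → S v ≡ true → classOf v ≢ hF → label τ₃ v ≡ Maybe.map ι (H.label σ′ (nameOf (classOf v)))
      l-rest v s nv with classOf v ≟ h
      ... | yes e with label-class v s e
      ...   | b , eb rewrite e | named | H.intro-label-new σ a c =
        relabelAll-to fC (ι c) τ₂ v (fC b) (trans (joinIf-label (adjFirst h) fC ℓF τ₁ v) eb) (inj₂ (b , refl))
      l-rest v s nv | no n rewrite H.intro-label-≢ σ a c (not-a v n) with H.label σ (nameOf (classOf v)) in em
      ... | nothing = relabelAll-absent fC (ι c) τ₂ v before
        where before = trans (joinIf-label (adjFirst h) fC ℓF τ₁ v) (trans (label-other v n) (trans (label-rest v s nv) (cong (Maybe.map ι) em)))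
      ... | just c′ = relabelAll-keep fC (ι c) τ₂ v (ι c′) before (λ b q → ι≢fC c′ b (sym q))
        where before = trans (joinIf-label (adjFirst h) fC ℓF τ₁ v) (trans (label-other v n) (trans (label-rest v s nv) (cong (Maybe.map ι) em)))
      l-first : ∀ v → S v ≡ true → classOf v ≡ hF → label τ₃ v ≡ just ℓF
      l-first v s e = relabelAll-keep fC (ι c) τ₂ v ℓF
        (trans (joinIf-label (adjFirst h) fC ℓF τ₁ v) (trans (label-other v (first≢h v e)) (label-first v s e))) fC≢ℓF
      l-outside : ∀ v → S v ≡ false → Absent τ₃ v
      l-outside v s = relabelAll-absent fC (ι c) τ₂ v
        (trans (joinIf-label (adjFirst h) fC ℓF τ₁ v) (trans (P.untouched-label v (Class-outside mp h v s)) (label-outside v s)))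

      first-∉fC : ∀ v → S v ≡ true → classOf v ≡ hF → ∀ x → label τ₁ v ≢ just (fC x)
      first-∉fC v s e x q = fC≢ℓF x (just-injective (trans (sym q) (trans (label-other v (first≢h v e)) (label-first v s e))))
      class-≢ℓF : ∀ v → S v ≡ true → classOf v ≡ h → label τ₁ v ≢ just ℓF
      class-≢ℓF v s e q with label-class v s e
      ... | b , eb = fC≢ℓF b (just-injective (trans (sym eb) q))
      rest-≢ℓF : ∀ v → S v ≡ true → classOf v ≢ hF → classOf v ≢ h → label τ₁ v ≢ just ℓF
      rest-≢ℓF v s nv n q = ι-label-≢ℓF (H.label σ (nameOf (classOf v))) (trans (sym (label-rest v s nv)) (trans (sym (label-other v n)) q))
      rest-∉fC : ∀ v → S v ≡ true → classOf v ≢ hF → classOf v ≢ h → ∀ x → label τ₁ v ≢ just (fC x)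
      rest-∉fC v s nv n x q = ι-label-≢fC (H.label σ (nameOf (classOf v))) x (trans (sym (label-rest v s nv)) (trans (sym (label-other v n)) q))

      edge-τ₃ : ∀ u w → edge τ₃ u w ≡ edge τ₂ u w
      edge-τ₃ = relabelAll-edge fC (ι c) τ₂
      unjoined : ∀ u w → label τ₁ u ≢ just ℓF → label τ₁ w ≢ just ℓF → edge τ₂ u w ≡ edge τ₁ u w
      unjoined = joinIf-edge-≢ℓ (adjFirst h) fC ℓF τ₁

      e-first : ∀ u w → S u ≡ true → S w ≡ true → classOf u ≡ hF → classOf w ≡ hF → edge τ₃ u w ≡ adj G u w
      e-first u w su sw eu ew = begin
        edge τ₃ u w  ≡⟨ edge-τ₃ u w ⟩
        edge τ₂ u w  ≡⟨ joinIf-edge-∉image (adjFirst h) fC ℓF τ₁ u w (first-∉fC u su eu) (first-∉fC w sw ew) ⟩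
        edge τ₁ u w  ≡⟨ P.untouched-edge u w (Class-other mp h u (first≢h u eu)) (Class-other mp h w (first≢h w ew)) ⟩
        edge τ u w   ≡⟨ edge-first u w su sw eu ew ⟩
        adj G u w    ∎
        where open ≡-Reasoning

      e-quotient : ∀ u w → S u ≡ true → S w ≡ true → classOf u ≢ hF → classOf w ≢ hF → classOf u ≢ classOf w →
                   edge τ₃ u w ≡ H.edge σ′ (nameOf (classOf u)) (nameOf (classOf w))
      e-quotient u w su sw nu nw nuw with classOf u ≟ h | classOf w ≟ h
      ... | yes eu | yes ew = ⊥-elim (nuw (trans eu (sym ew)))
      ... | yes eu | no n₂ rewrite eu | named | H.intro-edge-newˡ σ a c (nameOf (classOf w)) =
        trans (edge-τ₃ u w) (trans (unjoined u w (class-≢ℓF u su eu) (rest-≢ℓF w sw nw n₂))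
          (P.cross-edgeˡ u w (Class-intro mp h u su eu) (Class-other mp h w n₂)))
      ... | no n₁ | yes ew rewrite ew | named | H.intro-edge-newʳ σ a c (nameOf (classOf u)) =
        trans (edge-τ₃ u w) (trans (unjoined u w (rest-≢ℓF u su nu n₁) (class-≢ℓF w sw ew))
          (P.cross-edgeʳ u w (Class-other mp h u n₁) (Class-intro mp h w sw ew)))
      ... | no n₁ | no n₂ rewrite H.intro-edge-≢ σ a c (not-a u n₁) (not-a w n₂) =
        trans (edge-τ₃ u w) (trans (unjoined u w (rest-≢ℓF u su nu n₁) (rest-≢ℓF w sw nw n₂))
          (trans (P.untouched-edge u w (Class-other mp h u n₁) (Class-other mp h w n₂)) (edge-quotient u w su sw nu nw nuw)))

      e-same : ∀ u w → S u ≡ true → S w ≡ true → classOf u ≢ hF → classOf u ≡ classOf w →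
               H.Present σ′ (nameOf (classOf u)) → edge τ₃ u w ≡ adj G u w
      e-same u w su sw nu euw pr with classOf u ≟ h
      ... | yes eu = trans (edge-τ₃ u w) (trans (unjoined u w (class-≢ℓF u su eu) (class-≢ℓF w sw ew))
                       (P.placed-edge u w (Class-intro mp h u su eu) (Class-intro mp h w sw ew)))
        where ew = trans (sym euw) eu
      ... | no n₁ = trans (edge-τ₃ u w) (trans (unjoined u w (rest-≢ℓF u su nu n₁) (rest-≢ℓF w sw nw n₂))
                      (trans (P.untouched-edge u w (Class-other mp h u n₁) (Class-other mp h w n₂))
                        (edge-same-class u w su sw nu euw (present-before-intro σ a c _ (not-a u n₁) pr))))
        where
        nw : classOf w ≢ hF
        nw q = nu (trans euw q)
        n₂ : classOf w ≢ h
        n₂ q = n₁ (trans euw q)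

      adj-first-class : ∀ u w → S u ≡ true → S w ≡ true → classOf u ≡ hF → classOf w ≡ h → adj G u w ≡ adjFirst h
      adj-first-class u w su sw eu ew =
        trans (adj-across u w su sw (λ q → hF≢h (trans (sym eu) (trans q ew))))
              (trans (cong₂ (λ x y → adj G (rep x) (rep y)) eu ew) (Graph.sym G (rep hF) (rep h)))

      edges-first-class : ∀ u w → S u ≡ true → S w ≡ true → classOf u ≡ hF → classOf w ≡ h → ∀ b → adjFirst h ≡ b →
                          edge (nrun τ₁ (joinIf b fC ℓF)) u w ≡ adj G u w × edge (nrun τ₁ (joinIf b fC ℓF)) w u ≡ adj G w u
      edges-first-class u w su sw eu ew true eb with label-class w sw ew
      ... | b , e with joinAll-joins fC ℓF τ₁ w u b e (trans (label-other u (first≢h u eu)) (label-first u su eu)) (fC≢ℓF b)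
      ...   | j₁ , j₂ = trans j₂ (sym (trans (adj-first-class u w su sw eu ew) eb)) ,
                        trans j₁ (sym (trans (Graph.sym G w u) (trans (adj-first-class u w su sw eu ew) eb)))
      edges-first-class u w su sw eu ew false eb =
        trans (P.cross-edgeʳ u w (Class-other mp h u (first≢h u eu)) (Class-intro mp h w sw ew))
              (sym (trans (adj-first-class u w su sw eu ew) eb)) ,
        trans (P.cross-edgeˡ w u (Class-intro mp h w sw ew) (Class-other mp h u (first≢h u eu)))
              (sym (trans (Graph.sym G w u) (trans (adj-first-class u w su sw eu ew) eb)))

      e-first-rest : ∀ u w → S u ≡ true → S w ≡ true → classOf u ≡ hF → classOf w ≢ hF →
                     H.Present σ′ (nameOf (classOf w)) → edge τ₃ u w ≡ adj G u w × edge τ₃ w u ≡ adj G w u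
      e-first-rest u w su sw eu nw pr with classOf w ≟ h
      ... | yes ew with edges-first-class u w su sw eu ew (adjFirst h) refl
      ...   | j₁ , j₂ = trans (edge-τ₃ u w) j₁ , trans (edge-τ₃ w u) j₂
      e-first-rest u w su sw eu nw pr | no n₂ =
        trans (edge-τ₃ u w) (trans (joinIf-edge-∉image (adjFirst h) fC ℓF τ₁ u w (first-∉fC u su eu) (rest-∉fC w sw nw n₂))
          (trans (P.untouched-edge u w (Class-other mp h u (first≢h u eu)) (Class-other mp h w n₂)) (proj₁ before))) ,
        trans (edge-τ₃ w u) (trans (joinIf-edge-∉image (adjFirst h) fC ℓF τ₁ w u (rest-∉fC w sw nw n₂) (first-∉fC u su eu))
          (trans (P.untouched-edge w u (Class-other mp h w n₂) (Class-other mp h u (first≢h u eu))) (proj₂ before)))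
        where before = edge-first-rest u w su sw eu nw (present-before-intro σ a c _ (not-a w n₂) pr)

      introduced : Invariant σ′ (nrun τ introOps) × ValidOver S τ introOps
      introduced =
        subst (Invariant σ′) (sym introOps-run)
          (record { label-rest = l-rest ; label-first = l-first ; label-outside = l-outside ; edge-first = e-first
                  ; edge-quotient = e-quotient ; edge-same-class = e-same ; edge-first-rest = e-first-rest }) ,
        valid-++ τ opsH _ (valid-mono τ opsH (Class⊆S mp h) (proj₂ placedH))
          (valid-++ τ₁ (joinIf (adjFirst h) fC ℓF) _ (joinIf-valid (adjFirst h) fC ℓF τ₁) (relabelAll-valid fC (ι c) τ₂))

    invariant-step : ∀ {σ τ} o → Invariant σ τ → H.ValidOver (λ _ → true) σ (o ∷ []) →
                     H.AllIntroduced (λ a → nameOf (vertexOf a) ≡ a) (o ∷ []) →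
                     Invariant (H.nstep σ o) (nrun τ (translate o)) × ValidOver S τ (translate o)
    invariant-step (H.nintro a c) inv (_ , fresh , _) (named , _) with vertexOf a ≟ hF
    ... | yes e = invariant-skip a c e inv , tt
    ... | no ne = IntroduceClass.introduced a c (vertexOf a) ne named fresh inv
    invariant-step (H.njoin i j p) inv _ _ = invariant-join i j p inv , tt
    invariant-step (H.nrelabel i j p) inv _ _ = invariant-relabel i j p inv , tt

    invariant-run : ∀ {σ τ} os → Invariant σ τ → H.ValidOver (λ _ → true) σ os →
                    H.AllIntroduced (λ a → nameOf (vertexOf a) ≡ a) os →
                    Invariant (H.nrun σ os) (nrun τ (translateAll os)) × ValidOver S τ (translateAll os)
    invariant-run [] inv _ _ = inv , tt
    invariant-run {σ} {τ} (o ∷ os) inv val named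
      with invariant-step o inv (H.valid-head o os val) (H.allIntroduced-head o os named)
    ... | inv₁ , val₁ with invariant-run os inv₁ (H.valid-tail o os val) (H.allIntroduced-tail o os named)
    ...   | inv₂ , val₂ = subst (Invariant _) (sym (nrun-++ τ (translate o) (translateAll os))) inv₂ ,
                          valid-++ τ (translate o) (translateAll os) val₁ val₂

    allOps = opsF ++ (relabelAll fF ℓF ++ translateAll nops)
    final = invariant-run nops invariant-start valid named-intros
    open Invariant (proj₁ final)
    τFinal = nrun τStart (translateAll nops)

    allOps-run : nrun nempty allOps ≡ τFinal
    allOps-run = trans (nrun-++ nempty opsF _) (nrun-++ (nrun nempty opsF) (relabelAll fF ℓF) _)

    present-all : ∀ v → S v ≡ true → Present τFinal v
    present-all v s with classOf v ≟ hF
    ... | yes e = ℓF , label-first v s e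
    ... | no n with present-final (classOf v)
    ...   | b , eb = ι b , trans (label-rest v s n) (cong (Maybe.map ι) eb)

    edges-all : ∀ u w → S u ≡ true → S w ≡ true → edge τFinal u w ≡ adj G u w
    edges-all u w su sw with classOf u ≟ hF | classOf w ≟ hF
    ... | yes eu | yes ew = edge-first u w su sw eu ew
    ... | yes eu | no nw = proj₁ (edge-first-rest u w su sw eu nw (present-final (classOf w)))
    ... | no nu | yes ew = proj₂ (edge-first-rest w u sw su ew nu (present-final (classOf u)))
    ... | no nu | no nw with classOf u ≟ classOf w
    ...   | yes euw = edge-same-class u w su sw nu euw (present-final (classOf u))
    ...   | no nuw = trans (edge-quotient u w su sw nu nw nuw)
                       (trans (edge-final (classOf u) (classOf w)) (sym (adj-across u w su sw nuw)))

    substituted : Builder S K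
    substituted = record
      { ops = allOps
      ; valid = valid-++ nempty opsF _ (valid-mono nempty opsF (Class⊆S mp hF) (proj₂ placedF))
                  (valid-++ (nrun nempty opsF) (relabelAll fF ℓF) _ (relabelAll-valid fF ℓF _) (proj₂ final))
      ; present = λ v s → subst (λ τ → Present τ v) (sym allOps-run) (present-all v s)
      ; edges = λ u w su sw → subst (λ τ → edge τ u w ≡ adj G u w) (sym allOps-run) (edges-all u w su sw) }

  quotient-induced : ∀ {S} (mp : ModularPartition S) → InducedSubgraph (quotient mp) G
  quotient-induced mp = record
    { emb = rep ; emb-inj = λ {x} {y} e → trans (sym (classOf-rep x)) (trans (cong classOf e) (classOf-rep y)) ; emb-adj = λ _ _ → refl }
    where open ModularPartition mp

-- Induced copies of Q and co-Q

Compose : Bool → Graph → Graph → Graph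
Compose false = _⊎ᴳ_
Compose true = _∗ᴳ_

Family : Bool → ℕ → Graph
Family false = Q
Family true = coQ

Family-suc : ∀ b t → Family b (suc (suc t)) ≡ Compose b (Compose (not b) K1 (Family b (suc t))) (Family b (suc t))
Family-suc false t = refl
Family-suc true t = refl

module Induced (G : Graph) where

  Vx : Set
  Vx = Fin (size G)

  record InducedIn (H : Graph) (S : Vx → Bool) : Set where
    constructor induced
    field
      embed           : Fin (size H) → Vx
      embed-injective : ∀ x y → embed x ≡ embed y → x ≡ y
      embed-adj       : ∀ x y → adj H x y ≡ adj G (embed x) (embed y)
      embed-∈         : ∀ x → S (embed x) ≡ true
  open InducedIn public

  IsInducedBy : (H : Graph) → (Vx → Bool) → (Fin (size H) → Vx) → Set
  IsInducedBy H S f = (∀ x y → f x ≡ f y → x ≡ y) × (∀ x y → adj H x y ≡ adj G (f x) (f y)) × (∀ x → S (f x) ≡ true)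

  inducedIn? : ∀ H S → Dec (InducedIn H S)
  inducedIn? H S with functions-searchable (size H) Fin-searchable (IsInducedBy H S) decide respects
    where
    decide : ∀ f → Dec (IsInducedBy H S f)
    decide f = all? (λ x → all? (λ y → (f x ≟ f y) →-dec (x ≟ y)))
               ×-dec (all? (λ x → all? λ y → adj H x y Bool.≟ adj G (f x) (f y)) ×-dec all? (λ x → S (f x) Bool.≟ true))
    respects : ∀ f g → (∀ i → f i ≡ g i) → IsInducedBy H S f → IsInducedBy H S g
    respects f g e (inj , a , s) = (λ x y q → inj x y (trans (e x) (trans q (sym (e y))))) ,
                               (λ x y → trans (a x y) (cong₂ (adj G) (e x) (e y))) ,
                               (λ x → trans (cong S (sym (e x))) (s x))
  ... | yes (f , inj , a , s) = yes (induced f inj a s)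
  ... | no ¬f = no λ e → ¬f (embed e , embed-injective e , embed-adj e , embed-∈ e)

  inducedIn-mono : ∀ {H S S′} → InducedIn H S → S ⊆ S′ → InducedIn H S′
  inducedIn-mono (induced e inj a s) sub = induced e inj a (λ x → sub (e x) (s x))

  inducedIn⇒InducedSubgraph : ∀ {H S} → InducedIn H S → InducedSubgraph H G
  inducedIn⇒InducedSubgraph (induced e inj a _) = record { emb = e ; emb-inj = λ {x} {y} → inj x y ; emb-adj = a }

  K1-inducedIn : ∀ {S} v → S v ≡ true → InducedIn K1 S
  K1-inducedIn v s = induced (λ _ → v) (λ { zero zero _ → refl }) (λ { zero zero → sym (irrefl G v) }) (λ _ → s)

  copair : ∀ {a b} → (Fin a → Vx) → (Fin b → Vx) → Fin (a + b) → Vx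
  copair {a} f g z = [ f , g ]′ (splitAt a z)

  copair-cases : ∀ {a b} (f : Fin a → Vx) (g : Fin b → Vx) z →
                 (Σ (Fin a) λ x → copair f g z ≡ f x) ⊎ (Σ (Fin b) λ y → copair f g z ≡ g y)
  copair-cases {a} f g z with splitAt a z
  ... | inj₁ x = inj₁ (x , refl)
  ... | inj₂ y = inj₂ (y , refl)

  copair-injective : ∀ {a b} (f : Fin a → Vx) (g : Fin b → Vx) → (∀ x y → f x ≡ f y → x ≡ y) →
                     (∀ x y → g x ≡ g y → x ≡ y) → (∀ x y → f x ≢ g y) → ∀ z₁ z₂ → copair f g z₁ ≡ copair f g z₂ → z₁ ≡ z₂
  copair-injective {a} {b} f g f-inj g-inj disjoint z₁ z₂ q with splitAt a z₁ in e₁ | splitAt a z₂ in e₂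
  ... | inj₁ x | inj₁ y = splitAt-injective (trans e₁ (trans (cong inj₁ (f-inj x y q)) (sym e₂)))
    where splitAt-injective : splitAt a z₁ ≡ splitAt a z₂ → z₁ ≡ z₂
          splitAt-injective e = trans (sym (join-splitAt a b z₁)) (trans (cong (Fin.join a b) e) (join-splitAt a b z₂))
  ... | inj₂ x | inj₂ y = splitAt-injective (trans e₁ (trans (cong inj₂ (g-inj x y q)) (sym e₂)))
    where splitAt-injective : splitAt a z₁ ≡ splitAt a z₂ → z₁ ≡ z₂
          splitAt-injective e = trans (sym (join-splitAt a b z₁)) (trans (cong (Fin.join a b) e) (join-splitAt a b z₂))
  ... | inj₁ x | inj₂ y = ⊥-elim (disjoint x y q)
  ... | inj₂ x | inj₁ y = ⊥-elim (disjoint y x (sym q))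

  copair-∈ : ∀ {a b} {S : Vx → Bool} (f : Fin a → Vx) (g : Fin b → Vx) → (∀ x → S (f x) ≡ true) → (∀ y → S (g y) ≡ true) →
            ∀ z → S (copair f g z) ≡ true
  copair-∈ {a} f g f-∈ g-∈ z with splitAt a z
  ... | inj₁ x = f-∈ x
  ... | inj₂ y = g-∈ y

  compose-inducedIn : ∀ b {S} (A B : Graph) (eA : InducedIn A S) (eB : InducedIn B S) → (∀ x y → embed eA x ≢ embed eB y) →
                      (∀ x y → adj G (embed eA x) (embed eB y) ≡ b) → InducedIn (Compose b A B) S
  compose-inducedIn false {S} A B (induced f f-inj f-adj f-∈) (induced g g-inj g-adj g-∈) disjoint across =
    induced (copair f g) (copair-injective f g f-inj g-inj disjoint) adjacency (copair-∈ {S = S} f g f-∈ g-∈)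
    where
    adjacency : ∀ x y → adj (A ⊎ᴳ B) x y ≡ adj G (copair f g x) (copair f g y)
    adjacency x y with splitAt (size A) x | splitAt (size A) y
    ... | inj₁ a | inj₁ c = f-adj a c
    ... | inj₂ a | inj₂ c = g-adj a c
    ... | inj₁ a | inj₂ c = sym (across a c)
    ... | inj₂ a | inj₁ c = sym (trans (Graph.sym G (g a) (f c)) (across c a))
  compose-inducedIn true {S} A B (induced f f-inj f-adj f-∈) (induced g g-inj g-adj g-∈) disjoint across =
    induced (copair f g) (copair-injective f g f-inj g-inj disjoint) adjacency (copair-∈ {S = S} f g f-∈ g-∈)
    where
    adjacency : ∀ x y → adj (A ∗ᴳ B) x y ≡ adj G (copair f g x) (copair f g y)
    adjacency x y with splitAt (size A) x | splitAt (size A) y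
    ... | inj₁ a | inj₁ c = f-adj a c
    ... | inj₂ a | inj₂ c = g-adj a c
    ... | inj₁ a | inj₂ c = sym (across a c)
    ... | inj₂ a | inj₁ c = sym (trans (Graph.sym G (g a) (f c)) (across c a))

  compose-cases : ∀ b {S} (A B : Graph) (eA : InducedIn A S) (eB : InducedIn B S) d c z →
                  (Σ (Fin (size A)) λ x → embed (compose-inducedIn b A B eA eB d c) z ≡ embed eA x) ⊎
                  (Σ (Fin (size B)) λ y → embed (compose-inducedIn b A B eA eB d c) z ≡ embed eB y)
  compose-cases false A B eA eB d c z = copair-cases (embed eA) (embed eB) z
  compose-cases true A B eA eB d c z = copair-cases (embed eA) (embed eB) z

  -- Family b (t+2) is a vertex v composed with polarity (not b) with a copy X of Family b (t+1),
  -- all composed with polarity b with a second copy Y.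
  family-step : ∀ b {S} t v (X Y : Vx → Bool) → S v ≡ true → X ⊆ S → Y ⊆ S →
                InducedIn (Family b (suc t)) X → InducedIn (Family b (suc t)) Y →
                X v ≡ false → Y v ≡ false → (∀ x → X x ≡ true → Y x ≡ false) →
                (∀ x → X x ≡ true → adj G v x ≡ not b) → (∀ y → Y y ≡ true → adj G v y ≡ b) →
                (∀ x y → X x ≡ true → Y y ≡ true → adj G x y ≡ b) → InducedIn (Family b (suc (suc t))) S
  family-step b {S} t v X Y v∈S X⊆S Y⊆S eX eY v∉X v∉Y X∩Y v-X v-Y X-Y =
    subst (λ F → InducedIn F S) (sym (Family-suc b t))
      (compose-inducedIn b (Compose (not b) K1 F) F vX eY′ disjoint across)
    where
    F = Family b (suc t)
    eY′ = inducedIn-mono eY Y⊆S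
    ∉ : ∀ (Z : Vx → Bool) {u w} → Z u ≡ true → Z w ≡ false → u ≢ w
    ∉ Z zu zw refl = true≢false (trans (sym zu) zw)
    v-≢X : ∀ (_ : Fin 1) a → v ≢ embed eX a
    v-≢X _ a e = ∉ X (embed-∈ eX a) v∉X (sym e)
    v-adjX : ∀ (_ : Fin 1) a → adj G v (embed eX a) ≡ not b
    v-adjX _ a = v-X _ (embed-∈ eX a)
    vX = compose-inducedIn (not b) K1 F (K1-inducedIn v v∈S) (inducedIn-mono eX X⊆S) v-≢X v-adjX
    vX-cases = compose-cases (not b) K1 F (K1-inducedIn v v∈S) (inducedIn-mono eX X⊆S) v-≢X v-adjX
    disjoint : ∀ z c → embed vX z ≢ embed eY′ c
    disjoint z c q with vX-cases z
    ... | inj₁ (_ , p) = ∉ Y (embed-∈ eY c) v∉Y (sym (trans (sym p) q))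
    ... | inj₂ (a , p) = ∉ Y (embed-∈ eY c) (X∩Y _ (embed-∈ eX a)) (sym (trans (sym p) q))
    across : ∀ z c → adj G (embed vX z) (embed eY′ c) ≡ b
    across z c with vX-cases z
    ... | inj₁ (_ , p) rewrite p = v-Y _ (embed-∈ eY c)
    ... | inj₂ (a , p) rewrite p = X-Y _ _ (embed-∈ eX a) (embed-∈ eY c)

-- Splits, prime graphs and maximal modules

module Splits (G : Graph) where
  open Induced G

  Crosses : (Vx → Bool) → (Vx → Bool) → Bool → Vx → Vx → Set
  Crosses T S b x y = T x ≡ true → S y ≡ true → T y ≡ false → adj G x y ≡ b

  -- T is one side of G[S] written as a disjoint union (b = false) or a join (b = true)
  record Split (b : Bool) (S T : Vx → Bool) : Set where
    constructor split
    field
      side⊆   : T ⊆ S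
      inside  : Σ Vx λ v → T v ≡ true
      outside : Σ Vx λ v → S v ≡ true × T v ≡ false
      across  : ∀ x y → Crosses T S b x y

  Crossing : Bool → (Vx → Bool) → (Vx → Bool) → Set
  Crossing b T S = Σ Vx λ x → Σ Vx λ y → T x ≡ true × S y ≡ true × T y ≡ false × adj G x y ≡ b

  Unsplittable : (Vx → Bool) → Set
  Unsplittable S = ∀ T → T ⊆ S → Σ Vx (λ v → T v ≡ true) → Σ Vx (λ v → S v ≡ true × T v ≡ false) → ∀ b → Crossing b T S

  crosses? : ∀ T S b x y → Dec (Crosses T S b x y)
  crosses? T S b x y = (T x Bool.≟ true) →-dec ((S y Bool.≟ true) →-dec ((T y Bool.≟ false) →-dec (adj G x y Bool.≟ b)))

  split? : ∀ b (S : Vx → Bool) → Dec (Σ (Vx → Bool) (Split b S))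
  split? b S = map′ (λ (T , (s , i , o , a)) → T , split s i o a)
                    (λ (T , split s i o a) → T , (s , i , o , a))
                    (functions-searchable (size G) Bool-searchable _ decide respects)
    where
    decide : ∀ T → Dec (T ⊆ S × Σ Vx (λ v → T v ≡ true) × Σ Vx (λ v → S v ≡ true × T v ≡ false) ×
                        (∀ x y → Crosses T S b x y))
    decide T = all? (λ v → (T v Bool.≟ true) →-dec (S v Bool.≟ true))
               ×-dec (any? (λ v → T v Bool.≟ true)
               ×-dec (any? (λ v → (S v Bool.≟ true) ×-dec (T v Bool.≟ false))
               ×-dec all? (λ x → all? (crosses? T S b x))))
    respects : ∀ T T′ → (∀ i → T i ≡ T′ i) → _ → _
    respects T T′ e (s , (v , tv) , (w , sw , tw) , a) =
      (λ v t → s v (trans (e v) t)) , (v , trans (sym (e v)) tv) , (w , sw , trans (sym (e w)) tw) ,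
      (λ x y tx sy ty → a x y (trans (e x) tx) sy (trans (e y) ty))

  unsplittable : ∀ S → (∀ b → ¬ Σ _ (Split b S)) → Unsplittable S
  unsplittable S ¬split T T⊆S inside outside b
    with ¬∀²⇒∃¬ (size G) (Crosses T S (not b)) (crosses? T S (not b)) (λ a → ¬split (not b) (T , split T⊆S inside outside a))
  ... | x , y , ¬p = x , y , tx , sy , ty , adj≡b
    where
    tx = ¬→-premise (T x Bool.≟ true) ¬p
    sy = ¬→-premise (S y Bool.≟ true) (¬→-conclusion ¬p)
    ty = ¬→-premise (T y Bool.≟ false) (¬→-conclusion (¬→-conclusion ¬p))
    adj≡b : adj G x y ≡ b
    adj≡b = trans (¬-not (¬→-conclusion (¬→-conclusion (¬→-conclusion ¬p)))) (not-involutive b)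

  split-trans : ∀ b (S B T : Vx → Bool) → Split b S B → Split b B T → Split b S T
  split-trans b S B T (split B⊆S _ (y₀ , sy₀ , by₀) acrossB) (split T⊆B inT _ acrossT) =
    split (λ v t → B⊆S v (T⊆B v t)) inT (y₀ , sy₀ , ty₀) across
    where
    ty₀ : T y₀ ≡ false
    ty₀ with T y₀ in e
    ... | false = refl
    ... | true = ⊥-elim (true≢false (trans (sym (T⊆B y₀ e)) by₀))
    across : ∀ x y → T x ≡ true → S y ≡ true → T y ≡ false → adj G x y ≡ b
    across x y tx sy ty with B y in e
    ... | true = acrossT x y tx e ty
    ... | false = acrossB x y (T⊆B x tx) sy e

  -- refines T until it has no b-split itself; each refinement is strictly smaller
  indivisible-side : ∀ b (S T : Vx → Bool) → Split b S T → Σ (Vx → Bool) λ B → Split b S B × ¬ Σ _ (Split b B)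
  indivisible-side b S T sp = go (count T) T ≤-refl sp
    where
    go : ∀ fuel T → count T ≤ fuel → Split b S T → Σ (Vx → Bool) λ B → Split b S B × ¬ Σ _ (Split b B)
    go fuel T bound sp with split? b T
    ... | no ¬sp = T , sp , ¬sp
    go zero T bound sp | yes (T′ , sp′@(split T′⊆T _ (y , ty , t′y) _)) =
      ⊥-elim (n≮0 (<-≤-trans (count-< T′ T T′⊆T y ty t′y) bound))
    go (suc fuel) T bound sp | yes (T′ , sp′@(split T′⊆T _ (y , ty , t′y) _)) =
      go fuel T′ (≤-pred (≤-trans (count-< T′ T T′⊆T y ty t′y) bound)) (split-trans b S T T′ sp sp′)

  unsplittable-nonuniform : ∀ {S} → Unsplittable S → ∀ T → T ⊆ S → Σ Vx (λ v → T v ≡ true) →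
                            Σ Vx (λ v → S v ≡ true × T v ≡ false) → ∀ c → ¬ (∀ x z → Crosses T S c x z)
  unsplittable-nonuniform unsplit T T⊆S inside outside c uniform
    with unsplit T T⊆S inside outside (not c)
  ... | x , z , tx , sz , tz , adj≡¬c = not-¬ (uniform x z tx sz tz) adj≡¬c

module _ {n} (h₁ h₂ : Fin n) where

  pair : Fin n → Bool
  pair y = (y == h₁) ∨ (y == h₂)

  pair-h₁ : pair h₁ ≡ true
  pair-h₁ rewrite ==-refl h₁ = refl

  pair-h₂ : pair h₂ ≡ true
  pair-h₂ rewrite ==-refl h₂ = ∨-zeroʳ _

  pair-∌ : ∀ {c} → c ≢ h₁ → c ≢ h₂ → pair c ≡ false
  pair-∌ c≢h₁ c≢h₂ rewrite ==-≢ c≢h₁ | ==-≢ c≢h₂ = refl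

  pair-elim : ∀ y → pair y ≡ true → y ≡ h₁ ⊎ y ≡ h₂
  pair-elim y e with y == h₁ in e₁
  ... | true = inj₁ (==-≡ e₁)
  ... | false = inj₂ (==-≡ e)

module _ (H : Graph) (h₁ h₂ : Fin (size H)) where

  PairModuleAt : Fin (size H) → Fin (size H) → Fin (size H) → Set
  PairModuleAt v x y = pair h₁ h₂ v ≡ false → pair h₁ h₂ x ≡ true → pair h₁ h₂ y ≡ true → adj H v x ≡ adj H v y

  pairModuleAt? : ∀ v x y → Dec (PairModuleAt v x y)
  pairModuleAt? v x y = (pair h₁ h₂ v Bool.≟ false) →-dec ((pair h₁ h₂ x Bool.≟ true) →-dec
                        ((pair h₁ h₂ y Bool.≟ true) →-dec (adj H v x Bool.≟ adj H v y)))

  pair-distinguished : Prime H → (c : Fin (size H)) → h₁ ≢ h₂ → c ≢ h₁ → c ≢ h₂ →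
                       Σ (Fin (size H)) λ v → v ≢ h₁ × v ≢ h₂ × adj H v h₁ ≢ adj H v h₂
  pair-distinguished (_ , trivial) c h₁≢h₂ c≢h₁ c≢h₂ with all? (λ v → all? (λ x → all? (pairModuleAt? v x)))
  ... | yes isModule with trivial (pair h₁ h₂) isModule
  ...   | inj₁ none = ⊥-elim (true≢false (trans (sym (pair-h₁ h₁ h₂)) (none h₁)))
  ...   | inj₂ (inj₁ (_ , _ , only)) = ⊥-elim (h₁≢h₂ (trans (only h₁ (pair-h₁ h₁ h₂)) (sym (only h₂ (pair-h₂ h₁ h₂)))))
  ...   | inj₂ (inj₂ every) = ⊥-elim (true≢false (trans (sym (every c)) (pair-∌ h₁ h₂ c≢h₁ c≢h₂)))
  pair-distinguished _ c h₁≢h₂ c≢h₁ c≢h₂ | no ¬module with ¬∀³⇒∃¬ (size H) PairModuleAt pairModuleAt? ¬module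
  ... | v , x , y , ¬p = v , v≢ h₁ (pair-h₁ h₁ h₂) , v≢ h₂ (pair-h₂ h₁ h₂) ,
                         distinguishes (pair-elim h₁ h₂ x px) (pair-elim h₁ h₂ y py)
    where
    pv = ¬→-premise (pair h₁ h₂ v Bool.≟ false) ¬p
    px = ¬→-premise (pair h₁ h₂ x Bool.≟ true) (¬→-conclusion ¬p)
    py = ¬→-premise (pair h₁ h₂ y Bool.≟ true) (¬→-conclusion (¬→-conclusion ¬p))
    differ = ¬→-conclusion (¬→-conclusion (¬→-conclusion ¬p))
    v≢ : ∀ h → pair h₁ h₂ h ≡ true → v ≢ h
    v≢ h ph refl = true≢false (trans (sym ph) pv)
    distinguishes : x ≡ h₁ ⊎ x ≡ h₂ → y ≡ h₁ ⊎ y ≡ h₂ → adj H v h₁ ≢ adj H v h₂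
    distinguishes (inj₁ refl) (inj₁ refl) _ = differ refl
    distinguishes (inj₂ refl) (inj₂ refl) _ = differ refl
    distinguishes (inj₁ refl) (inj₂ refl) e = differ e
    distinguishes (inj₂ refl) (inj₁ refl) e = differ (sym e)

module Gallai (G : Graph) where
  open Induced G
  open Splits G
  open Quotients G using (ModularPartition; quotient)

  IsModuleOf : (Vx → Bool) → (Vx → Bool) → Set
  IsModuleOf S M = M ⊆ S × (∀ v x y → S v ≡ true → M v ≡ false → M x ≡ true → M y ≡ true → adj G v x ≡ adj G v y)

  ProperModule : (Vx → Bool) → (Vx → Bool) → Set
  ProperModule S M = IsModuleOf S M × Σ Vx (λ v → S v ≡ true × M v ≡ false)

  properModule? : ∀ (S M : Vx → Bool) → Dec (ProperModule S M)
  properModule? S M =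
    (all? (λ v → (M v Bool.≟ true) →-dec (S v Bool.≟ true))
     ×-dec all? (λ v → all? (λ x → all? (λ y → (S v Bool.≟ true) →-dec ((M v Bool.≟ false) →-dec
                   ((M x Bool.≟ true) →-dec ((M y Bool.≟ true) →-dec (adj G v x Bool.≟ adj G v y))))))))
    ×-dec any? (λ v → (S v Bool.≟ true) ×-dec (M v Bool.≟ false))

  Maximal : (Vx → Bool) → (Vx → Bool) → Set
  Maximal S M = ∀ T → ProperModule S T → M ⊆ T → T ⊆ M

  module-∪ : ∀ S M₁ M₂ w → IsModuleOf S M₁ → IsModuleOf S M₂ → M₁ w ≡ true → M₂ w ≡ true →
             IsModuleOf S (λ u → M₁ u ∨ M₂ u)
  module-∪ S M₁ M₂ w (M₁⊆S , mod₁) (M₂⊆S , mod₂) w₁ w₂ = ⊆S , mod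
    where
    ⊆S : (λ u → M₁ u ∨ M₂ u) ⊆ S
    ⊆S u e with M₁ u in e₁
    ... | true = M₁⊆S u e₁
    ... | false = M₂⊆S u e
    via-w : ∀ v x → S v ≡ true → M₁ v ≡ false → M₂ v ≡ false → (M₁ x ∨ M₂ x) ≡ true → adj G v x ≡ adj G v w
    via-w v x sv n₁ n₂ e with M₁ x in e₁
    ... | true = mod₁ v x w sv n₁ e₁ w₁
    ... | false = mod₂ v x w sv n₂ e w₂
    mod : ∀ v x y → S v ≡ true → (M₁ v ∨ M₂ v) ≡ false → (M₁ x ∨ M₂ x) ≡ true → (M₁ y ∨ M₂ y) ≡ true →
          adj G v x ≡ adj G v y
    mod v x y sv nv ex ey with M₁ v in e₁
    ... | false = trans (via-w v x sv e₁ nv ex) (sym (via-w v y sv e₁ nv ey))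

  properModule-respects : ∀ S (T T′ : Vx → Bool) → (∀ i → T i ≡ T′ i) → ProperModule S T → ProperModule S T′
  properModule-respects S T T′ e ((T⊆S , mod) , (w , sw , tw)) =
    ((λ v t → T⊆S v (trans (e v) t)) ,
     (λ v x y sv tv tx ty → mod v x y sv (trans (e v) tv) (trans (e x) tx) (trans (e y) ty))) ,
    (w , sw , trans (sym (e w)) tw)

  -- Gallai: the maximal proper modules of an unsplittable G[S] with |S| ≥ 2 partition S,
  -- and the quotient by this partition is prime.
  module MaximalModules (S : Vx → Bool) (unsplit : Unsplittable S) (a₀ b₀ : Vx)
                        (a₀∈S : S a₀ ≡ true) (b₀∈S : S b₀ ≡ true) (a₀≢b₀ : a₀ ≢ b₀) where

    Enlarges : (Vx → Bool) → (Vx → Bool) → Set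
    Enlarges M T = ProperModule S T × M ⊆ T × Σ Vx λ w → T w ≡ true × M w ≡ false

    enlargement? : ∀ M → Dec (Σ (Vx → Bool) (Enlarges M))
    enlargement? M = functions-searchable (size G) Bool-searchable (Enlarges M) decide respects
      where
      decide : ∀ T → Dec (Enlarges M T)
      decide T = properModule? S T ×-dec (all? (λ v → (M v Bool.≟ true) →-dec (T v Bool.≟ true))
                 ×-dec any? (λ w → (T w Bool.≟ true) ×-dec (M w Bool.≟ false)))
      respects : ∀ T T′ → (∀ i → T i ≡ T′ i) → Enlarges M T → Enlarges M T′
      respects T T′ e (pm , sub , w , tw , mw) =
        properModule-respects S T T′ e pm , (λ v m → trans (sym (e v)) (sub v m)) , w , trans (sym (e w)) tw , mw

    grow : ∀ fuel M → ProperModule S M → count S ≤ count M + fuel →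
           Σ (Vx → Bool) λ M′ → ProperModule S M′ × M ⊆ M′ × Maximal S M′
    grow fuel M pm bound with enlargement? M
    ... | no ¬bigger = M , pm , (λ _ m → m) , maximal
      where
      maximal : Maximal S M
      maximal T pmT sub v tv with M v in e
      ... | true = refl
      ... | false = ⊥-elim (¬bigger (T , pmT , sub , v , tv , e))
    grow zero M pm bound | yes (T , pmT@((T⊆S , _) , _) , sub , w , tw , mw) =
      ⊥-elim (<-irrefl refl (<-≤-trans (count-< M T sub w tw mw)
                                      (≤-trans (count-mono T S T⊆S) (≤-trans bound (≤-reflexive (+-identityʳ _))))))
    grow (suc fuel) M pm bound | yes (T , pmT , sub , w , tw , mw) with grow fuel T pmT bound′
      where
      bound′ : count S ≤ count T + fuel
      bound′ = ≤-trans bound (≤-trans (≤-reflexive (+-suc (count M) fuel)) (+-monoˡ-≤ fuel (count-< M T sub w tw mw)))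
    ... | M′ , pm′ , sub′ , max′ = M′ , pm′ , (λ v m → sub′ v (sub v m)) , max′

    singleton : Vx → Vx → Bool
    singleton v u = ⌊ u ≟ v ⌋

    singleton-≡ : ∀ v u → singleton v u ≡ true → u ≡ v
    singleton-≡ v u e with u ≟ v
    ... | yes p = p

    singleton-self : ∀ v → singleton v v ≡ true
    singleton-self v with v ≟ v
    ... | yes _ = refl
    ... | no v≢v = ⊥-elim (v≢v refl)

    another-in-S : ∀ v → Σ Vx λ w → S w ≡ true × w ≢ v
    another-in-S v with v ≟ a₀
    ... | yes refl = b₀ , b₀∈S , (λ e → a₀≢b₀ (sym e))
    ... | no v≢a₀ = a₀ , a₀∈S , (λ e → v≢a₀ (sym e))

    singleton-proper : ∀ v → S v ≡ true → ProperModule S (singleton v)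
    singleton-proper v sv with another-in-S v
    ... | w , sw , w≢v = (⊆S , mod) , (w , sw , w∉)
      where
      ⊆S : singleton v ⊆ S
      ⊆S u e rewrite singleton-≡ v u e = sv
      mod : ∀ z x y → S z ≡ true → singleton v z ≡ false → singleton v x ≡ true → singleton v y ≡ true → adj G z x ≡ adj G z y
      mod z x y _ _ ex ey rewrite singleton-≡ v x ex | singleton-≡ v y ey = refl
      w∉ : singleton v w ≡ false
      w∉ with w ≟ v
      ... | yes e = ⊥-elim (w≢v e)
      ... | no _ = refl

    maximal-around : ∀ v → S v ≡ true → Σ (Vx → Bool) λ M → ProperModule S M × M v ≡ true × Maximal S M
    maximal-around v sv with grow (count S) (singleton v) (singleton-proper v sv) (m≤n+m (count S) (count (singleton v)))
    ... | M , pm , sub , max = M , pm , sub v (singleton-self v) , max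

    moduleOfAt : ∀ v b → S v ≡ b → Vx → Bool
    moduleOfAt v true e = proj₁ (maximal-around v e)
    moduleOfAt v false e = λ _ → false

    -- empty when v ∉ S
    moduleOf : Vx → Vx → Bool
    moduleOf v = moduleOfAt v (S v) refl

    moduleOf-spec : ∀ v → S v ≡ true → ProperModule S (moduleOf v) × moduleOf v v ≡ true × Maximal S (moduleOf v)
    moduleOf-spec v sv = spec (S v) refl sv
      where
      spec : ∀ b (e : S v ≡ b) → b ≡ true →
             ProperModule S (moduleOfAt v b e) × moduleOfAt v b e v ≡ true × Maximal S (moduleOfAt v b e)
      spec true e _ = proj₂ (maximal-around v e)

    moduleOf⊆S : ∀ v u → S v ≡ true → moduleOf v u ≡ true → S u ≡ true
    moduleOf⊆S v u sv e = proj₁ (proj₁ (proj₁ (moduleOf-spec v sv))) u e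

    moduleOf-mod : ∀ v → S v ≡ true → ∀ z x y → S z ≡ true → moduleOf v z ≡ false → moduleOf v x ≡ true → moduleOf v y ≡ true →
                   adj G z x ≡ adj G z y
    moduleOf-mod v sv = proj₂ (proj₁ (proj₁ (moduleOf-spec v sv)))

    moduleOf-self : ∀ v → S v ≡ true → moduleOf v v ≡ true
    moduleOf-self v sv = proj₁ (proj₂ (moduleOf-spec v sv))

    -- If two proper modules covered S, then every edge from M₁ ∖ M₂ to the rest of S would
    -- have the same value as a fixed edge between M₂ ∖ M₁ and M₁ ∖ M₂.
    no-covering-pair : ∀ M₁ M₂ → ProperModule S M₁ → ProperModule S M₂ → (∀ z → S z ≡ true → (M₁ z ∨ M₂ z) ≡ true) → ⊥
    no-covering-pair M₁ M₂ ((M₁⊆S , mod₁) , (p₁ , sp₁ , ¬p₁)) ((M₂⊆S , mod₂) , (p₂ , sp₂ , ¬p₂)) cover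
      with any? (λ x → (M₁ x Bool.≟ true) ×-dec (M₂ x Bool.≟ false))
    ... | no ¬x = ¬x (p₂ , M₁p₂ , ¬p₂)
      where
      M₁p₂ : M₁ p₂ ≡ true
      M₁p₂ with cover p₂ sp₂
      ... | c rewrite ¬p₂ | ∨-identityʳ (M₁ p₂) = c
    ... | yes (x , m₁x , m₂x) with any? (λ y → (M₂ y Bool.≟ true) ×-dec (M₁ y Bool.≟ false))
    ...   | no ¬y = ¬y (p₁ , M₂p₁ , ¬p₁)
      where
      M₂p₁ : M₂ p₁ ≡ true
      M₂p₁ with cover p₁ sp₁
      ... | c rewrite ¬p₁ = c
    ...   | yes (y , m₂y , m₁y) =
      unsplittable-nonuniform unsplit X X⊆S (x , Xx) (y , M₂⊆S y m₂y , Xy) (adj G y x) uniform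
      where
      X : Vx → Bool
      X u = M₁ u ∧ not (M₂ u)
      X-elim : ∀ u → X u ≡ true → M₁ u ≡ true × M₂ u ≡ false
      X-elim u e with M₁ u | M₂ u
      ... | true | false = refl , refl
      outside-X : ∀ u → S u ≡ true → X u ≡ false → M₂ u ≡ true
      outside-X u su xu with M₁ u | M₂ u | cover u su
      ... | _ | true | _ = refl
      outside-X u su () | true | false | _
      X⊆S : X ⊆ S
      X⊆S u e = M₁⊆S u (proj₁ (X-elim u e))
      Xx : X x ≡ true
      Xx rewrite m₁x | m₂x = refl
      Xy : X y ≡ false
      Xy rewrite m₁y = refl
      uniform : ∀ x′ z → Crosses X S (adj G y x) x′ z
      uniform x′ z tx sz tz with X-elim x′ tx
      ... | m₁x′ , m₂x′ = trans (mod₂ x′ z y (M₁⊆S x′ m₁x′) m₂x′ (outside-X z sz tz) m₂y)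
                                (trans (Graph.sym G x′ y) (mod₁ y x′ x (M₂⊆S y m₂y) m₁y m₁x′ m₁x))

    ∨-introˡ : ∀ {a b} → a ≡ true → (a ∨ b) ≡ true
    ∨-introˡ refl = refl

    ∨-introʳ : ∀ {a b} → b ≡ true → (a ∨ b) ≡ true
    ∨-introʳ {a} refl = ∨-zeroʳ a

    union-proper : ∀ v w → S v ≡ true → S w ≡ true → moduleOf v w ≡ true → ProperModule S (λ u → moduleOf v u ∨ moduleOf w u)
    union-proper v w sv sw vw with moduleOf-spec v sv | moduleOf-spec w sw
                                 | any? (λ z → (S z Bool.≟ true) ×-dec ((moduleOf v z ∨ moduleOf w z) Bool.≟ false))
    ... | (im₁ , _) , _ | (im₂ , _) , ww , _ | yes outside = module-∪ S (moduleOf v) (moduleOf w) w im₁ im₂ vw ww , outside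
    ... | pm₁ , _ | pm₂ , _ | no ¬outside = ⊥-elim (no-covering-pair (moduleOf v) (moduleOf w) pm₁ pm₂ cover)
      where
      cover : ∀ z → S z ≡ true → (moduleOf v z ∨ moduleOf w z) ≡ true
      cover z sz with moduleOf v z ∨ moduleOf w z in e
      ... | true = refl
      ... | false = ⊥-elim (¬outside (z , sz , e))

    moduleOf-same : ∀ v w → S v ≡ true → S w ≡ true → moduleOf v w ≡ true → ∀ u → moduleOf w u ≡ moduleOf v u
    moduleOf-same v w sv sw vw u with moduleOf w u in e₁ | moduleOf v u in e₂
    ... | true | true = refl
    ... | false | false = refl
    ... | true | false = ⊥-elim (true≢false (trans (sym (max-v U (union-proper v w sv sw vw) (λ _ → ∨-introˡ) u (∨-introʳ e₁))) e₂))
      where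
      U = λ u → moduleOf v u ∨ moduleOf w u
      max-v = proj₂ (proj₂ (moduleOf-spec v sv))
    ... | false | true = ⊥-elim (true≢false (trans (sym (max-w U (union-proper v w sv sw vw) (λ _ → ∨-introʳ) u (∨-introˡ e₂))) e₁))
      where
      U = λ u → moduleOf v u ∨ moduleOf w u
      max-w = proj₂ (proj₂ (moduleOf-spec w sw))

    leader : Vx → Maybe Vx
    leader v = firstTrue (moduleOf v)

    leader-spec : ∀ v → S v ≡ true → Σ Vx λ m → leader v ≡ just m × moduleOf v m ≡ true
    leader-spec v sv with firstTrue-complete (moduleOf v) v (moduleOf-self v sv)
    ... | m , e = m , e , firstTrue-sound (moduleOf v) m e

    leader-same : ∀ v w → S v ≡ true → S w ≡ true → moduleOf v w ≡ true → leader w ≡ leader v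
    leader-same v w sv sw vw = firstTrue-cong (moduleOf w) (moduleOf v) (moduleOf-same v w sv sw vw)

    leader-idempotent : ∀ v m → S v ≡ true → leader v ≡ just m → leader m ≡ just m
    leader-idempotent v m sv e = trans (leader-same v m sv (moduleOf⊆S v m sv vm) vm) e
      where vm = firstTrue-sound (moduleOf v) m e

    isLeader : Vx → Bool
    isLeader x = S x ∧ ⌊ Maybe.≡-dec _≟_ (leader x) (just x) ⌋

    isLeader-intro : ∀ x → S x ≡ true → leader x ≡ just x → isLeader x ≡ true
    isLeader-intro x sx e with Maybe.≡-dec _≟_ (leader x) (just x)
    ... | yes _ = cong (_∧ true) sx
    ... | no ne = ⊥-elim (ne e)

    isLeader-elim : ∀ x → isLeader x ≡ true → S x ≡ true × leader x ≡ just x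
    isLeader-elim x e = ∧-conicalˡ (S x) _ e , ⌊⌋-true (Maybe.≡-dec _≟_ (leader x) (just x)) (∧-conicalʳ (S x) _ e)

    leaders : List Vx
    leaders = filter (λ x → isLeader x Bool.≟ true) (allFin (size G))

    classes : ℕ
    classes = length leaders

    rep : Fin classes → Vx
    rep = lookup leaders

    rep-injective : ∀ i j → rep i ≡ rep j → i ≡ j
    rep-injective = Unique-lookup-injective (Unique.filter⁺ (λ x → isLeader x Bool.≟ true) (Unique.allFin⁺ (size G)))

    rep-isLeader : ∀ h → isLeader (rep h) ≡ true
    rep-isLeader h = proj₂ (∈-filter⁻ (λ x → isLeader x Bool.≟ true) {xs = allFin (size G)} (∈-lookup h))

    isLeader⇒rep : ∀ m → isLeader m ≡ true → Σ (Fin classes) λ h → rep h ≡ m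
    isLeader⇒rep m e = index m∈ , sym (lookup-index m∈)
      where
      m∈ : m ∈ leaders
      m∈ = ∈-filter⁺ (λ x → isLeader x Bool.≟ true) (∈-allFin m) e

    rep∈S : ∀ h → S (rep h) ≡ true
    rep∈S h = proj₁ (isLeader-elim (rep h) (rep-isLeader h))

    -- junk class for leaderless vertices, i.e. those outside S
    defaultClass : Fin classes
    defaultClass with leader-spec a₀ a₀∈S
    ... | m , e , a₀m = proj₁ (isLeader⇒rep m (isLeader-intro m (moduleOf⊆S a₀ m a₀∈S a₀m) (leader-idempotent a₀ m a₀∈S e)))

    classOfLeader : Maybe Vx → Fin classes
    classOfLeader nothing = defaultClass
    classOfLeader (just m) with any? (λ h → rep h ≟ m)
    ... | yes (h , _) = h
    ... | no _ = defaultClass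

    classOfLeader-rep : ∀ m → isLeader m ≡ true → rep (classOfLeader (just m)) ≡ m
    classOfLeader-rep m e with any? (λ h → rep h ≟ m)
    ... | yes (h , q) = q
    ... | no ¬h = ⊥-elim (¬h (isLeader⇒rep m e))

    classOf : Vx → Fin classes
    classOf v = classOfLeader (leader v)

    rep-classOf-∈ : ∀ v → S v ≡ true → moduleOf v (rep (classOf v)) ≡ true
    rep-classOf-∈ v sv with leader-spec v sv
    ... | m , e , vm = subst (λ z → moduleOf v z ≡ true) (sym rep≡m) vm
      where
      rep≡m : rep (classOf v) ≡ m
      rep≡m = trans (cong (λ x → rep (classOfLeader x)) e)
                    (classOfLeader-rep m (isLeader-intro m (moduleOf⊆S v m sv vm) (leader-idempotent v m sv e)))

    classOf-rep : ∀ h → classOf (rep h) ≡ h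
    classOf-rep h with isLeader-elim (rep h) (rep-isLeader h)
    ... | _ , e = rep-injective _ _ q
      where
      q : rep (classOf (rep h)) ≡ rep h
      q rewrite e = classOfLeader-rep (rep h) (rep-isLeader h)

    classOf-same : ∀ v w → S v ≡ true → S w ≡ true → moduleOf v w ≡ true → classOf w ≡ classOf v
    classOf-same v w sv sw vw = cong classOfLeader (leader-same v w sv sw vw)

    moduleOf-∌ : ∀ u w → S u ≡ true → S w ≡ true → classOf u ≢ classOf w → moduleOf u w ≡ false
    moduleOf-∌ u w su sw ne with moduleOf u w in e
    ... | true = ⊥-elim (ne (sym (classOf-same u w su sw e)))
    ... | false = refl

    adj-across : ∀ u w → S u ≡ true → S w ≡ true → classOf u ≢ classOf w → adj G u w ≡ adj G (rep (classOf u)) (rep (classOf w))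
    adj-across u w su sw ne = begin
      adj G u w    ≡⟨ Graph.sym G u w ⟩
      adj G w u    ≡⟨ moduleOf-mod u su w u ru sw (moduleOf-∌ u w su sw ne) (moduleOf-self u su) (rep-classOf-∈ u su) ⟩
      adj G w ru   ≡⟨ Graph.sym G w ru ⟩
      adj G ru w   ≡⟨ moduleOf-mod w sw ru w rw ru∈S (moduleOf-∌ w ru sw ru∈S (λ e → ne′ (sym e))) (moduleOf-self w sw) (rep-classOf-∈ w sw) ⟩
      adj G ru rw  ∎
      where
      open ≡-Reasoning
      ru = rep (classOf u)
      rw = rep (classOf w)
      ru∈S : S ru ≡ true
      ru∈S = moduleOf⊆S u ru su (rep-classOf-∈ u su)
      ne′ : classOf ru ≢ classOf w
      ne′ e = ne (trans (sym (classOf-same u ru su ru∈S (rep-classOf-∈ u su))) e)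

    partition : ModularPartition S
    partition = record
      { classes = classes ; rep = rep ; classOf = classOf ; rep∈S = rep∈S ; classOf-rep = classOf-rep ; adj-across = adj-across }

    at-least-two-classes : 2 ≤ classes
    at-least-two-classes with proj₂ (proj₁ (moduleOf-spec a₀ a₀∈S))
    ... | w , sw , a₀w = distinct⇒2≤ (classOf a₀) (classOf w) λ e → true≢false (trans (sym (w∈ e)) a₀w)
      where
      w∈ : classOf a₀ ≡ classOf w → moduleOf a₀ w ≡ true
      w∈ e = trans (sym (moduleOf-same a₀ m a₀∈S m∈S (rep-classOf-∈ a₀ a₀∈S) w))
                   (trans (moduleOf-same w m sw m∈S wm w) (moduleOf-self w sw))
        where
        m = rep (classOf a₀)
        m∈S = moduleOf⊆S a₀ m a₀∈S (rep-classOf-∈ a₀ a₀∈S)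
        wm : moduleOf w m ≡ true
        wm = subst (λ z → moduleOf w (rep z) ≡ true) (sym e) (rep-classOf-∈ w sw)

    pullback : (Fin classes → Bool) → Vx → Bool
    pullback P x = S x ∧ P (classOf x)

    pullback-module : ∀ P → IsModule (quotient partition) P → IsModuleOf S (pullback P)
    pullback-module P P-mod = (λ x e → ∧-conicalˡ (S x) _ e) , mod
      where
      mod : ∀ z x y → S z ≡ true → pullback P z ≡ false → pullback P x ≡ true → pullback P y ≡ true → adj G z x ≡ adj G z y
      mod z x y sz pz px py = trans (adj-across z x sz sx z≢x) (trans (P-mod (classOf z) (classOf x) (classOf y) ¬Pz Px Py)
                                (sym (adj-across z y sz sy z≢y)))
        where
        sx = ∧-conicalˡ (S x) _ px
        sy = ∧-conicalˡ (S y) _ py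
        Px = ∧-conicalʳ (S x) _ px
        Py = ∧-conicalʳ (S y) _ py
        ¬Pz : P (classOf z) ≡ false
        ¬Pz = trans (sym (cong (_∧ P (classOf z)) sz)) pz
        z≢x : classOf z ≢ classOf x
        z≢x e = true≢false (trans (sym Px) (trans (cong P (sym e)) ¬Pz))
        z≢y : classOf z ≢ classOf y
        z≢y e = true≢false (trans (sym Py) (trans (cong P (sym e)) ¬Pz))

    -- a nontrivial module P ∋ a, b of the quotient pulls back to a proper module containing
    -- the maximal module of rep a, hence equal to it, forcing b = a
    quotient-trivial : ∀ P → IsModule (quotient partition) P → TrivialModule (quotient partition) P
    quotient-trivial P P-mod with all? (λ x → P x Bool.≟ false)
    ... | yes none = inj₁ none
    ... | no ¬none with all? (λ x → P x Bool.≟ true)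
    ...   | yes every = inj₂ (inj₂ every)
    ...   | no ¬every with ¬∀⟶∃¬ classes _ (λ x → P x Bool.≟ false) ¬none | ¬∀⟶∃¬ classes _ (λ x → P x Bool.≟ true) ¬every
    ...     | a , ¬Pa | c , ¬Pc with all? (λ y → (P y Bool.≟ true) →-dec (y ≟ a))
    ...       | yes only-a = inj₂ (inj₁ (a , ¬-not ¬Pa , only-a))
    ...       | no ¬only-a with ¬∀⟶∃¬ classes _ (λ y → (P y Bool.≟ true) →-dec (y ≟ a)) ¬only-a
    ...         | b , ¬b = ⊥-elim (¬→-conclusion ¬b b≡a)
      where
      Pa : P a ≡ true
      Pa = ¬-not ¬Pa
      Pb : P b ≡ true
      Pb = ¬→-premise (P b Bool.≟ true) ¬b
      ra = rep a
      proper : ProperModule S (pullback P)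
      proper = pullback-module P P-mod , rep c , rep∈S c , rep-c∉
        where
        rep-c∉ : pullback P (rep c) ≡ false
        rep-c∉ = cong₂ _∧_ (rep∈S c) (trans (cong P (classOf-rep c)) (¬-not ¬Pc))
      module-a⊆ : moduleOf ra ⊆ pullback P
      module-a⊆ x e = cong₂ _∧_ sx (trans (cong P (trans (classOf-same ra x (rep∈S a) sx e) (classOf-rep a))) Pa)
        where sx = moduleOf⊆S ra x (rep∈S a) e
      b∈ : moduleOf ra (rep b) ≡ true
      b∈ = proj₂ (proj₂ (moduleOf-spec ra (rep∈S a))) (pullback P) proper module-a⊆ (rep b) pb
        where
        pb : pullback P (rep b) ≡ true
        pb = cong₂ _∧_ (rep∈S b) (trans (cong P (classOf-rep b)) Pb)
      b≡a : b ≡ a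
      b≡a = trans (sym (classOf-rep b)) (trans (classOf-same ra (rep b) (rep∈S a) (rep∈S b) b∈) (classOf-rep a))

    quotient-prime : Prime (quotient partition)
    quotient-prime = at-least-two-classes , quotient-trivial

  gallai : ∀ S → Unsplittable S → ∀ a₀ b₀ → S a₀ ≡ true → S b₀ ≡ true → a₀ ≢ b₀ →
           Σ (ModularPartition S) λ mp → Prime (quotient mp)
  gallai S unsplit a₀ b₀ a₀∈S b₀∈S a₀≢b₀ = partition , quotient-prime
    where open MaximalModules S unsplit a₀ b₀ a₀∈S b₀∈S a₀≢b₀

module Construction (G : Graph) (m : ℕ) (prime-width : (H : Graph) → InducedSubgraph H G → Prime H → lcw≤ H m) where
  open Building G
  open Quotients G
  open Induced G hiding (Vx)
  open Splits G
  open Gallai G using (gallai)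

  everything : Vx → Bool
  everything _ = true

  width : ℕ → ℕ
  width zero = suc m
  width (suc k) = suc (m + suc (width k))

  width≤ : ∀ k → suc (width k) ≤ m + suc (width k)
  width≤ k = m≤n+m (suc (width k)) m

  single-or-another : ∀ (B : Vx → Bool) x₀ → B x₀ ≡ true → (Σ Vx λ w → B w ≡ true × w ≢ x₀) ⊎ (∀ v → B v ≡ true → v ≡ x₀)
  single-or-another B x₀ bx₀ with any? (λ w → (B w Bool.≟ true) ×-dec ¬? (w ≟ x₀))
  ... | yes (w , bw , w≢x₀) = inj₁ (w , bw , w≢x₀)
  ... | no ¬w = inj₂ only
    where
    only : ∀ v → B v ≡ true → v ≡ x₀
    only v bv with v ≟ x₀
    ... | yes e = e
    ... | no ne = ⊥-elim (¬w (v , bv , ne))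

  glue : ∀ b {S B kA kB K} → Split b S B → Builder (S ∖ B) kA → Builder B kB → kA ≤ suc K → kB ≤ K → Builder S (suc K)
  glue b {S} {B} sp bA bB kA≤ kB≤ =
    Combine.combined (S ∖ B) B S b (∖-∉ S B) (∖-cover S B) (∖⊆ S B) (Split.side⊆ sp) across bA bB kA≤ kB≤
    where
    across : ∀ u w → (S ∖ B) u ≡ true → B w ≡ true → adj G u w ≡ b
    across u w au bw = trans (Graph.sym G u w) (Split.across sp w u bw (∖⊆ S B u au) (∖-∉ S B u au))

  glue-swapped : ∀ b {S B kA kB K} → Split b S B → Builder B kA → Builder (S ∖ B) kB → kA ≤ suc K → kB ≤ K → Builder S (suc K)
  glue-swapped b {S} {B} sp bB bA kB≤ kA≤ =
    Combine.combined B (S ∖ B) S b (∈⇒∉∖ S B) cover (Split.side⊆ sp) (∖⊆ S B) across bB bA kB≤ kA≤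
    where
    cover : ∀ v → S v ≡ true → B v ≡ true ⊎ (S ∖ B) v ≡ true
    cover v sv = [ inj₂ , inj₁ ]′ (∖-cover S B v sv)
    across : ∀ u w → B u ≡ true → (S ∖ B) w ≡ true → adj G u w ≡ b
    across u w bu aw = Split.across sp u w bu (∖⊆ S B w aw) (∖-∉ S B w aw)

  -- a part X lying "beside" a copy A of Family b (p+1), seen alike from a vertex v, cannot
  -- contain another copy, since together with v they would form Family b (p+2)
  avoids-beside : ∀ b p {S} v (X A : Vx → Bool) → ¬ InducedIn (Family b (suc (suc p))) S → S v ≡ true → X ⊆ S → A ⊆ S →
                  InducedIn (Family b (suc p)) A → X v ≡ false → A v ≡ false → (∀ x → X x ≡ true → A x ≡ false) →
                  (∀ x → X x ≡ true → adj G v x ≡ not b) → (∀ y → A y ≡ true → adj G v y ≡ b) →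
                  (∀ x y → X x ≡ true → A y ≡ true → adj G x y ≡ b) → ¬ InducedIn (Family b (suc p)) X
  avoids-beside b p v X A ¬F v∈S X⊆S A⊆S eA v∉X v∉A X∩A v-X v-A X-A eX =
    ¬F (family-step b p v X A v∈S X⊆S A⊆S eX eA v∉X v∉A X∩A v-X v-A X-A)

  record QuotientExpression {S : Vx → Bool} (mp : ModularPartition S) : Set where
    field
      kH   : ℕ
      kH≤m : kH ≤ m
      expr : ByCounter.NamedExpr kH (quotient mp)

  quotientExpression : ∀ {S} (mp : ModularPartition S) → Prime (quotient mp) → QuotientExpression mp
  quotientExpression mp prime with prime-width (quotient mp) (quotient-induced mp) prime
  ... | k , k≤m , ops , iso = record { kH = k ; kH≤m = k≤m ; expr = ByCounter.namedExpr (quotient mp) (some (proj₁ prime)) ops iso }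

  uniform-neighbour : ∀ {S} → Unsplittable S → (mp : ModularPartition S) → Prime (quotient mp) → ∀ h b →
                      Σ Vx λ d → S d ≡ true × Class mp h d ≡ false × (∀ x → Class mp h x ≡ true → adj G d x ≡ b)
  uniform-neighbour {S} unsplit mp prime h b with another (proj₁ prime) h
  ... | h′ , h′≢h with unsplit (Class mp h) (Class⊆S mp h) (rep h , rep∈Class mp h)
                       (rep h′ , rep∈S h′ , Class-other mp h (rep h′) (λ e → h′≢h (trans (sym (classOf-rep h′)) e))) b
    where open ModularPartition mp
  ... | x₁ , d , cx₁ , sd , cd , adj≡b = d , sd , cd , λ x cx → trans (same x cx) (trans (Graph.sym G d x₁) adj≡b)
    where
    open ModularPartition mp
    d≢h : classOf d ≢ h
    d≢h e = true≢false (trans (sym (Class-intro mp h d sd e)) cd)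
    same : ∀ x → Class mp h x ≡ true → adj G d x ≡ adj G d x₁
    same x cx = trans (adj-between-classes mp (classOf d) h d x (Class-intro mp (classOf d) d sd refl) cx d≢h)
                      (sym (adj-between-classes mp (classOf d) h d x₁ (Class-intro mp (classOf d) d sd refl) cx₁ d≢h))

  both-polarities : ∀ {P : Bool → Set} b → P b → P (not b) → ∀ c → P c
  both-polarities false p _ false = p
  both-polarities false _ p true = p
  both-polarities true p _ true = p
  both-polarities true _ p false = p

  ¬inducedIn-mono : ∀ {H X S} → X ⊆ S → ¬ InducedIn H S → ¬ InducedIn H X
  ¬inducedIn-mono X⊆S ¬S eX = ¬S (inducedIn-mono eX X⊆S)

  module SplitCase (b : Bool) (p q f : ℕ) {S B : Vx → Bool} (bound : count S ≤ suc f)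
                   (¬F : ¬ InducedIn (Family b (suc (suc p))) S) (side : Split b S B) (indivisible : ¬ Σ _ (Split b B))
                   (ih-fuel : ∀ X → X ⊆ S → count X ≤ f → Builder X (width (suc (p + suc q))))
                   (ih-drop : ∀ X → X ⊆ S → ¬ InducedIn (Family b (suc p)) X → Builder X (width (p + suc q))) where
    open Split side renaming (side⊆ to B⊆S)

    A = S ∖ B
    k = p + suc q
    K = m + suc (width k)

    A-count : count A ≤ f
    A-count with inside
    ... | x₀ , bx₀ = ≤-pred (≤-trans (count-< A S (∖⊆ S B) x₀ (B⊆S x₀ bx₀) (∈⇒∉∖ S B x₀ bx₀)) bound)

    B-count : count B ≤ f
    B-count with outside
    ... | y₀ , sy₀ , by₀ = ≤-pred (≤-trans (count-< B S B⊆S y₀ sy₀ by₀) bound)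

    B-A : ∀ x y → B x ≡ true → A y ≡ true → adj G x y ≡ b
    B-A x y bx ay = across x y bx (∖⊆ S B y ay) (∖-∉ S B y ay)

    module CopyInA (FA : InducedIn (Family b (suc p)) A) where

      beside : ∀ v X → X ⊆ B → B v ≡ true → X v ≡ false → (∀ x → X x ≡ true → adj G v x ≡ not b) →
               ¬ InducedIn (Family b (suc p)) X
      beside v X X⊆B bv xv v-X =
        avoids-beside b p v X A ¬F (B⊆S v bv) (λ x e → B⊆S x (X⊆B x e)) (∖⊆ S B) FA xv (∈⇒∉∖ S B v bv)
                      (λ x e → ∈⇒∉∖ S B x (X⊆B x e)) v-X (λ y ay → B-A v y bv ay) (λ x y e ay → B-A x y (X⊆B x e) ay)

      drop : ∀ X → X ⊆ B → ¬ InducedIn (Family b (suc p)) X → Builder X (width k)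
      drop X X⊆B = ih-drop X (λ x e → B⊆S x (X⊆B x e))

      split-side : ∀ {X} → Split (not b) B X → Builder B (suc (width k))
      split-side {X} X-side@(split X⊆B (x₁ , x₁∈X) (y₁ , y₁∈B , y₁∉X) acrossX) =
        glue (not b) X-side (drop (B ∖ X) (∖⊆ B X) ¬F-rest) (drop X X⊆B ¬F-X) (n≤1+n _) ≤-refl
        where
        ¬F-X = beside y₁ X X⊆B y₁∈B y₁∉X (λ x ex → trans (Graph.sym G y₁ x) (acrossX x y₁ ex y₁∈B y₁∉X))
        ¬F-rest = beside x₁ (B ∖ X) (∖⊆ B X) (X⊆B x₁ x₁∈X) (∈⇒∉∖ B X x₁ x₁∈X)
                         (λ y ey → acrossX x₁ y x₁∈X (∖⊆ B X y ey) (∖-∉ B X y ey))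

      prime-side : Unsplittable B → ∀ x₀ w₀ → B x₀ ≡ true → B w₀ ≡ true → x₀ ≢ w₀ → Builder B K
      prime-side unsplit x₀ w₀ bx₀ bw₀ x₀≢w₀ with gallai B unsplit x₀ w₀ bx₀ bw₀ x₀≢w₀
      ... | mp , prime = Substitute.substituted mp expr (some (proj₁ prime)) (build (some (proj₁ prime))) (λ h _ → build h)
                           (≤-trans (n≤1+n _) (width≤ k)) (+-monoˡ-≤ (suc (width k)) kH≤m)
        where
        open QuotientExpression (quotientExpression mp prime)
        build : ∀ h → Builder (Class mp h) (width k)
        build h with uniform-neighbour unsplit mp prime h (not b)
        ... | d , bd , cd , d-C = drop (Class mp h) (Class⊆S mp h) (beside d (Class mp h) (Class⊆S mp h) bd cd d-C)

      built-B : Σ ℕ λ kB → kB ≤ K × Builder B kB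
      built-B with inside
      ... | x₀ , bx₀ with single-or-another B x₀ bx₀
      ...   | inj₂ only = 1 , ≤-trans (s≤s z≤n) (width≤ k) , singletonBuilder B x₀ bx₀ only
      ...   | inj₁ (w₀ , bw₀ , w₀≢x₀) with split? (not b) B
      ...     | yes (X , X-side) = suc (width k) , width≤ k , split-side X-side
      ...     | no ¬split = K , ≤-refl , prime-side (unsplittable B (both-polarities b indivisible ¬split)) x₀ w₀ bx₀ bw₀ (λ e → w₀≢x₀ (sym e))

    built : Builder S (width (suc k))
    built with inducedIn? (Family b (suc p)) B
    ... | no ¬FB = glue b side (ih-fuel A (∖⊆ S B) A-count) (ih-drop B B⊆S ¬FB) ≤-refl (≤-trans (n≤1+n _) (width≤ k))
    ... | yes _ with inducedIn? (Family b (suc p)) A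
    ...   | no ¬FA = glue-swapped b side (ih-fuel B B⊆S B-count) (ih-drop A (∖⊆ S B) ¬FA) ≤-refl (≤-trans (n≤1+n _) (width≤ k))
    ...   | yes FA with CopyInA.built-B FA
    ...     | kB , kB≤ , bB = glue b side (ih-fuel A (∖⊆ S B) A-count) bB ≤-refl kB≤

  -- G[S] is unsplittable: substitute into the prime quotient, building first the one class
  -- (if any) that contains both Q (t+1) and co-Q (s+1)
  module PrimeCase (t s f : ℕ) {S : Vx → Bool} (bound : count S ≤ suc f)
                   (¬Q : ¬ InducedIn (Q (suc (suc t))) S) (¬coQ : ¬ InducedIn (coQ (suc (suc s))) S)
                   (unsplit : Unsplittable S) (mp : ModularPartition S) (prime : Prime (quotient mp))
                   (ih-fuel : ∀ X → X ⊆ S → count X ≤ f → Builder X (width (suc t + suc s)))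
                   (ih-t : ∀ X → X ⊆ S → ¬ InducedIn (Q (suc t)) X → Builder X (width (t + suc s)))
                   (ih-s : ∀ X → X ⊆ S → ¬ InducedIn (coQ (suc s)) X → Builder X (width (t + suc s))) where
    open ModularPartition mp
    open QuotientExpression (quotientExpression mp prime)

    C : Fin classes → Vx → Bool
    C = Class mp

    Heavy : Fin classes → Set
    Heavy h = InducedIn (Q (suc t)) (C h) × InducedIn (coQ (suc s)) (C h)

    rep∉ : ∀ {v x} → v ≢ x → C x (rep v) ≡ false
    rep∉ {v} v≢x = Class-other mp _ (rep v) (λ e → v≢x (trans (sym (classOf-rep v)) e))

    class-family : ∀ b n v x y → v ≢ x → v ≢ y → x ≢ y → adj G (rep v) (rep x) ≡ not b → adj G (rep v) (rep y) ≡ b →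
                   adj G (rep x) (rep y) ≡ b → InducedIn (Family b (suc n)) (C x) → InducedIn (Family b (suc n)) (C y) →
                   InducedIn (Family b (suc (suc n))) S
    class-family b n v x y v≢x v≢y x≢y v-x v-y x-y eX eY =
      family-step b n (rep v) (C x) (C y) (rep∈S v) (Class⊆S mp x) (Class⊆S mp y) eX eY (rep∉ v≢x) (rep∉ v≢y)
        (λ z cz → Class-other mp y z (λ e → x≢y (trans (sym (proj₂ (Class-elim mp x z cz))) e)))
        (λ z cz → trans (adj-between-classes mp v x (rep v) z (rep∈Class mp v) cz v≢x) v-x)
        (λ z cz → trans (adj-between-classes mp v y (rep v) z (rep∈Class mp v) cz v≢y) v-y)
        (λ z w cz cw → trans (adj-between-classes mp x y z w cz cw x≢y) x-y)

    two-classes-contradiction : ∀ h₁ h₂ → h₁ ≢ h₂ → (∀ c → c ≡ h₁ ⊎ c ≡ h₂) → ⊥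
    two-classes-contradiction h₁ h₂ h₁≢h₂ only =
      unsplittable-nonuniform unsplit (C h₁) (Class⊆S mp h₁) (rep h₁ , rep∈Class mp h₁)
                              (rep h₂ , rep∈S h₂ , rep∉ (λ e → h₁≢h₂ (sym e))) (adj G (rep h₁) (rep h₂)) uniform
      where
      uniform : ∀ x z → Crosses (C h₁) S (adj G (rep h₁) (rep h₂)) x z
      uniform x z cx sz cz with only (classOf z)
      ... | inj₁ e = ⊥-elim (true≢false (trans (sym (Class-intro mp h₁ z sz e)) cz))
      ... | inj₂ e = trans (adj-between-classes mp h₁ h₂ x z cx (Class-intro mp h₂ z sz e) h₁≢h₂) refl

    at-most-one-heavy : ∀ h₁ h₂ → h₁ ≢ h₂ → Heavy h₁ → Heavy h₂ → ⊥
    at-most-one-heavy h₁ h₂ h₁≢h₂ (q₁ , c₁) (q₂ , c₂) with any? (λ c → ¬? (c ≟ h₁) ×-dec ¬? (c ≟ h₂))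
    ... | no ¬third = two-classes-contradiction h₁ h₂ h₁≢h₂ only
      where
      only : ∀ c → c ≡ h₁ ⊎ c ≡ h₂
      only c with c ≟ h₁ | c ≟ h₂
      ... | yes e | _ = inj₁ e
      ... | no _ | yes e = inj₂ e
      ... | no n₁ | no n₂ = ⊥-elim (¬third (c , n₁ , n₂))
    ... | yes (c , c≢h₁ , c≢h₂) with pair-distinguished (quotient mp) h₁ h₂ prime c h₁≢h₂ c≢h₁ c≢h₂
    ...   | v , v≢h₁ , v≢h₂ , differ = by-polarity (adj G (rep h₁) (rep h₂)) refl
      where
      pair-family : ∀ b n → InducedIn (Family b (suc n)) (C h₁) → InducedIn (Family b (suc n)) (C h₂) →
                    adj G (rep h₁) (rep h₂) ≡ b → InducedIn (Family b (suc (suc n))) S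
      pair-family b n e₁ e₂ h₁-h₂ with adj G (rep v) (rep h₁) Bool.≟ not b
      ... | yes v-h₁ = class-family b n v h₁ h₂ v≢h₁ v≢h₂ h₁≢h₂ v-h₁ v-h₂ h₁-h₂ e₁ e₂
        where
        v-h₂ : adj G (rep v) (rep h₂) ≡ b
        v-h₂ = trans (¬-not (λ e → differ (trans v-h₁ (sym e)))) (not-involutive b)
      ... | no ¬v-h₁ = class-family b n v h₂ h₁ v≢h₂ v≢h₁ (λ e → h₁≢h₂ (sym e)) v-h₂ v-h₁ (trans (Graph.sym G _ _) h₁-h₂) e₂ e₁
        where
        v-h₁ : adj G (rep v) (rep h₁) ≡ b
        v-h₁ = trans (¬-not ¬v-h₁) (not-involutive b)
        v-h₂ : adj G (rep v) (rep h₂) ≡ not b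
        v-h₂ = ¬-not (λ e → differ (trans v-h₁ (sym e)))
      by-polarity : ∀ b → adj G (rep h₁) (rep h₂) ≡ b → ⊥
      by-polarity false e = ¬Q (pair-family false t q₁ q₂ e)
      by-polarity true e = ¬coQ (pair-family true s c₁ c₂ e)

    first : Σ (Fin classes) λ hF → ∀ h → h ≢ hF → ¬ Heavy h
    first with any? (λ h → inducedIn? (Q (suc t)) (C h) ×-dec inducedIn? (coQ (suc s)) (C h))
    ... | yes (hF , heavyF) = hF , λ h h≢hF heavy → at-most-one-heavy h hF h≢hF heavy heavyF
    ... | no ¬heavy = some (proj₁ prime) , λ h _ heavy → ¬heavy (h , heavy)

    build-light : ∀ h → ¬ Heavy h → Builder (C h) (width (t + suc s))
    build-light h light with inducedIn? (Q (suc t)) (C h)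
    ... | no ¬q = ih-t (C h) (Class⊆S mp h) ¬q
    ... | yes q = ih-s (C h) (Class⊆S mp h) (λ c → light (q , c))

    class-count : ∀ h → count (C h) ≤ f
    class-count h with another (proj₁ prime) h
    ... | h′ , h′≢h = ≤-pred (≤-trans (count-< (C h) S (Class⊆S mp h) (rep h′) (rep∈S h′) (rep∉ h′≢h)) bound)

    built : Builder S (width (suc t + suc s))
    built = Substitute.substituted mp expr hF (ih-fuel (C hF) (Class⊆S mp hF) (class-count hF))
              (λ h h≢hF → build-light h (proj₂ first h h≢hF)) ≤-refl
              (≤-trans (+-monoˡ-≤ (suc (width (t + suc s))) kH≤m) (n≤1+n _))
      where hF = proj₁ first

  none-in : ∀ {S} → ¬ InducedIn K1 S → ∀ v → S v ≡ false
  none-in {S} ¬K1 v with S v in e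
  ... | true = ⊥-elim (¬K1 (K1-inducedIn v e))
  ... | false = refl

  count-zero : ∀ {S : Vx → Bool} → count S ≤ 0 → ∀ v → S v ≡ false
  count-zero {S} bound v with S v in e
  ... | true = ⊥-elim (n≮0 (<-≤-trans (count-< (λ _ → false) S (λ _ ()) v e refl) bound))
  ... | false = refl

  module Decompose (t s f : ℕ) (S : Vx → Bool) (bound : count S ≤ suc f)
                   (¬Q : ¬ InducedIn (Q (suc (suc t))) S) (¬coQ : ¬ InducedIn (coQ (suc (suc s))) S)
                   (ih-t : ∀ X → ¬ InducedIn (Q (suc t)) X → ¬ InducedIn (coQ (suc (suc s))) X → Builder X (width (t + suc s)))
                   (ih-s : ∀ X → ¬ InducedIn (Q (suc (suc t))) X → ¬ InducedIn (coQ (suc s)) X → Builder X (width (suc t + s)))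
                   (ih-fuel : ∀ X → count X ≤ f → ¬ InducedIn (Q (suc (suc t))) X → ¬ InducedIn (coQ (suc (suc s))) X →
                              Builder X (width (suc t + suc s))) where

    fuel : ∀ X → X ⊆ S → count X ≤ f → Builder X (width (suc t + suc s))
    fuel X X⊆S c = ih-fuel X c (¬inducedIn-mono X⊆S ¬Q) (¬inducedIn-mono X⊆S ¬coQ)

    drop-t : ∀ X → X ⊆ S → ¬ InducedIn (Q (suc t)) X → Builder X (width (t + suc s))
    drop-t X X⊆S ¬q = ih-t X ¬q (¬inducedIn-mono X⊆S ¬coQ)

    drop-s : ∀ X → X ⊆ S → ¬ InducedIn (coQ (suc s)) X → Builder X (width (t + suc s))
    drop-s X X⊆S ¬c = subst (λ k → Builder X (width k)) (sym (+-suc t s)) (ih-s X (¬inducedIn-mono X⊆S ¬Q) ¬c)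

    commuted : ∀ {X} a b → Builder X (width (a + b)) → Builder X (width (b + a))
    commuted {X} a b = subst (λ k → Builder X (width k)) (+-comm a b)

    built : Builder S (width (suc t + suc s))
    built with any? (λ v → S v Bool.≟ true)
    ... | no ¬v = emptyBuilder S (λ v → ¬-not (λ e → ¬v (v , e)))
    ... | yes (v₀ , sv₀) with single-or-another S v₀ sv₀
    ...   | inj₂ only = singletonBuilder S v₀ sv₀ only
    ...   | inj₁ (w₀ , sw₀ , w₀≢v₀) with split? false S | split? true S
    ...     | yes (T , sp) | _ with indivisible-side false S T sp
    ...       | B , side , indivisible = SplitCase.built false t s f bound ¬Q side indivisible fuel drop-t
    built | yes _ | inj₁ _ | no _ | yes (T , sp) with indivisible-side true S T sp
    ...       | B , side , indivisible =
      commuted (suc s) (suc t) (SplitCase.built true s t f bound ¬coQ side indivisible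
                                  (λ X X⊆S c → commuted (suc t) (suc s) (fuel X X⊆S c))
                                  (λ X X⊆S ¬c → commuted (suc t) s (ih-s X (¬inducedIn-mono X⊆S ¬Q) ¬c)))
    built | yes (v₀ , sv₀) | inj₁ (w₀ , sw₀ , w₀≢v₀) | no ¬split-false | no ¬split-true
      with unsplittable S (both-polarities false ¬split-false ¬split-true)
    ... | unsplit with gallai S unsplit v₀ w₀ sv₀ sw₀ (λ e → w₀≢v₀ (sym e))
    ...   | mp , prime = PrimeCase.built t s f bound ¬Q ¬coQ unsplit mp prime fuel drop-t drop-s

  builds : ∀ t s f (S : Vx → Bool) → count S ≤ f → ¬ InducedIn (Q (suc t)) S → ¬ InducedIn (coQ (suc s)) S →
           Builder S (width (t + s))
  builds zero s f S _ ¬Q _ = emptyBuilder S (none-in ¬Q)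
  builds (suc t) zero f S _ _ ¬coQ = emptyBuilder S (none-in ¬coQ)
  builds (suc t) (suc s) zero S bound _ _ = emptyBuilder S (count-zero bound)
  builds (suc t) (suc s) (suc f) S bound ¬Q ¬coQ =
    Decompose.built t s f S bound ¬Q ¬coQ (λ X → builds t (suc s) (count X) X ≤-refl)
                    (λ X → builds (suc t) s (count X) X ≤-refl) (builds (suc t) (suc s) f)

  width-closed : ∀ k → suc (width k) ≡ (m + 2) * suc k
  width-closed zero = sym (trans (*-identityʳ (m + 2)) (+-comm m 2))
  width-closed (suc k) = begin
    suc (suc (m + suc (width k)))   ≡⟨ cong suc (sym (+-suc m (suc (width k)))) ⟩
    suc (m + suc (suc (width k)))   ≡⟨ sym (+-suc m (suc (suc (width k)))) ⟩
    m + (2 + suc (width k))         ≡⟨ sym (+-assoc m 2 (suc (width k))) ⟩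
    (m + 2) + suc (width k)         ≡⟨ cong ((m + 2) +_) (width-closed k) ⟩
    (m + 2) + (m + 2) * suc k       ≡⟨ sym (*-suc (m + 2) (suc k)) ⟩
    (m + 2) * suc (suc k)           ∎
    where open ≡-Reasoning

  width-<-suc : ∀ k → width k < width (suc k)
  width-<-suc k = s≤s (≤-trans (n≤1+n (width k)) (m≤n+m (suc (width k)) m))

  width-too-small : ∀ t s → ¬ ((m + 2) * (suc t + suc s) ≤ width (t + s))
  width-too-small t s le = <-irrefl refl (≤-trans (width-<-suc (t + s)) (≤-trans (n≤1+n _) (≤-trans (≤-reflexive eq) le)))
    where
    eq : suc (width (suc (t + s))) ≡ (m + 2) * (suc t + suc s)
    eq = trans (width-closed (suc (t + s))) (cong (λ k → (m + 2) * suc k) (sym (+-suc t s)))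

  Q-or-coQ : ∀ t s → lcw≥ G ((m + 2) * (suc t + suc s)) → InducedSubgraph (Q (suc t)) G ⊎ InducedSubgraph (coQ (suc s)) G
  Q-or-coQ t s lcw-large with inducedIn? (Q (suc t)) everything | inducedIn? (coQ (suc s)) everything
  ... | yes q | _ = inj₁ (inducedIn⇒InducedSubgraph q)
  ... | no _ | yes c = inj₂ (inducedIn⇒InducedSubgraph c)
  ... | no ¬q | no ¬c =
    ⊥-elim (width-too-small t s (lcw-large (width (t + s)) (builder⇒linExpr (builds t s _ everything ≤-refl ¬q ¬c))))

proposition4p1 : (m t s : ℕ) → 1 ≤ m → 1 ≤ t → 1 ≤ s → (G : Graph) →
    ((H : Graph) → InducedSubgraph H G → Prime H → lcw≤ H m) →
    lcw≥ G ((m + 2) * (t + s)) →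
    InducedSubgraph (Q t) G ⊎ InducedSubgraph (coQ s) G
proposition4p1 m (suc t) (suc s) _ (s≤s _) (s≤s _) G prime-width = Construction.Q-or-coQ G m prime-width t s
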